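{- Let $p$ be a prime, $n,n'\ge0$ integers, $K=K_p^{n+n'}$ the mirahoric subgroup of $\mathrm{GL}_4(\mathbb{Z}_p)$ of level $p^{n+n'}$, and $P$ the $(2,2)$ block upper triangular parabolic of $\mathrm{GL}_4$. For $0\le i\le n+n'$ let $\xi_p^{(i)}=\begin{pmatrix}1&0&0&0\\0&1&0&0\\0&0&1&0\\0&p^i&0&1\end{pmatrix}$. Then $$\kappa_P\bigl(P(\mathbb{Q}_p)\cap\xi_p^{(i)}K(\xi_p^{(i)})^{ -1}\bigr)=K_p(n+n'-i)\times K_p(i).$$ In particular the left-hand side equals $K_p(n')\times K_p(n)$ for $i=n$ and $K_p(n)\times K_p(n')$ for $i=n'$.
   Context: $K_p^{m}=\{g\in\mathrm{GL}_4(\mathbb{Z}_p):\text{last row of }g\equiv(0,0,0,1)\bmod p^m\}$. For $m\ge0$, $K_p(m)=\{g\in\mathrm{GL}_2(\mathbb{Z}_p): g\equiv\begin{pmatrix}*&*\\0&1\end{pmatrix}\bmod p^m\}$, so $K_p(0)=\mathrm{GL}_2(\mathbb{Z}_p)$. $\kappa_P:P\to\mathrm{GL}_2\times\mathrm{GL}_2$, $\begin{pmatrix}A&B\\0&D\end{pmatrix}\mapsto(A,D)$. -}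

module Defs where

open import Data.Nat as ℕ using (ℕ; zero; suc; _∸_)
open import Data.Integer as ℤ using (ℤ; +_; _+_; _*_; _-_; -_; 0ℤ; 1ℤ)
open import Data.Integer.Tactic.RingSolver using (solve-∀)
open import Data.Fin using (Fin; zero; suc)
import Data.Fin
import Relation.Nullary
open import Data.Product using (Σ; ∃; _×_; _,_)
open import Relation.Binary.PropositionalEquality
  using (_≡_; refl; sym; trans; cong; cong₂)

infix 4 _≡_[mod_]
_≡_[mod_] : ℤ → ℤ → ℕ → Set
a ≡ b [mod m ] = Σ ℤ λ q → a - b ≡ q * (+ m)

private
  l-add : ∀ a a' b b' → (a' + b') - (a + b) ≡ (a' - a) + (b' - b)
  l-add = solve-∀
  l-mul : ∀ a a' b b' → a' * b' - a * b ≡ a' * (b' - b) + (a' - a) * b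
  l-mul = solve-∀
  l-neg : ∀ a a' → (- a') - (- a) ≡ (- 1ℤ) * (a' - a)
  l-neg = solve-∀
  l-sub : ∀ a → a - a ≡ 0ℤ * + 0
  l-sub = solve-∀

+-cong-mod : ∀ {m a a' b b'} → a' ≡ a [mod m ] → b' ≡ b [mod m ] →
             a' + b' ≡ a + b [mod m ]
+-cong-mod {m} {a} {a'} {b} {b'} (q , e) (r , f) =
  q + r , trans (l-add a a' b b')
           (trans (cong₂ _+_ e f) (sym (IP.*-distribʳ-+ (+ m) q r)))
  where import Data.Integer.Properties as IP

*-cong-mod : ∀ {m a a' b b'} → a' ≡ a [mod m ] → b' ≡ b [mod m ] →
             a' * b' ≡ a * b [mod m ]
*-cong-mod {m} {a} {a'} {b} {b'} (q , e) (r , f) =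
  a' * r + q * b ,
  trans (l-mul a a' b b')
   (trans (cong₂ (λ x y → a' * x + y * b) f e) (lemma a' r q b (+ m)))
  where
  lemma : ∀ x r q b M → x * (r * M) + (q * M) * b ≡ (x * r + q * b) * M
  lemma = solve-∀

neg-cong-mod : ∀ {m a a'} → a' ≡ a [mod m ] → (- a') ≡ (- a) [mod m ]
neg-cong-mod {m} {a} {a'} (q , e) =
  (- 1ℤ) * q , trans (l-neg a a') (trans (cong ((- 1ℤ) *_) e) (lemma q (+ m)))
  where
  lemma : ∀ q M → (- 1ℤ) * (q * M) ≡ ((- 1ℤ) * q) * M
  lemma = solve-∀

-- The p-adic integers ℤ_p, as the inverse limit lim ℤ/p^k:
-- compatible sequences (x_k) of integers with x_{k+1} ≡ x_k mod p^k.
-- Two such sequences are equal in ℤ_p iff x_k ≡ y_k mod p^k for all k.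

record ℤₚ (p : ℕ) : Set where
  constructor mkℤp
  field
    seq    : ℕ → ℤ
    compat : ∀ k → seq (suc k) ≡ seq k [mod p ℕ.^ k ]
open ℤₚ public

module _ {p : ℕ} where

  infix 4 _≡ₚ_[mod^_]
  _≡ₚ_[mod^_] : ℤₚ p → ℤₚ p → ℕ → Set
  x ≡ₚ y [mod^ m ] = seq x m ≡ seq y m [mod p ℕ.^ m ]

  infix 4 _≈ₚ_
  _≈ₚ_ : ℤₚ p → ℤₚ p → Set
  x ≈ₚ y = ∀ m → x ≡ₚ y [mod^ m ]

  fromℤ : ℤ → ℤₚ p
  fromℤ a = mkℤp (λ _ → a) (λ k → 0ℤ , l-sub a)

  0ₚ 1ₚ : ℤₚ p
  0ₚ = fromℤ 0ℤ
  1ₚ = fromℤ 1ℤ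

  infixl 6 _+ₚ_
  infixl 7 _*ₚ_
  _+ₚ_ : ℤₚ p → ℤₚ p → ℤₚ p
  x +ₚ y = mkℤp (λ k → seq x k + seq y k)
                (λ k → +-cong-mod {a = seq x k} {seq x (suc k)} {seq y k} {seq y (suc k)} (compat x k) (compat y k))

  _*ₚ_ : ℤₚ p → ℤₚ p → ℤₚ p
  x *ₚ y = mkℤp (λ k → seq x k * seq y k)
                (λ k → *-cong-mod {a = seq x k} {seq x (suc k)} {seq y k} {seq y (suc k)} (compat x k) (compat y k))

  -ₚ_ : ℤₚ p → ℤₚ p
  -ₚ x = mkℤp (λ k → - seq x k) (λ k → neg-cong-mod {a = seq x k} {seq x (suc k)} (compat x k))

Mat : ℕ → ℕ → Set
Mat p n = Fin n → Fin n → ℤₚ p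

sumFin : ∀ {p} n → (Fin n → ℤₚ p) → ℤₚ p
sumFin zero    f = 0ₚ
sumFin (suc n) f = f zero +ₚ sumFin n (λ i → f (suc i))

module _ {p n : ℕ} where

  infixl 7 _⊗_
  _⊗_ : Mat p n → Mat p n → Mat p n
  (A ⊗ B) i j = sumFin n (λ k → A i k *ₚ B k j)

  infix 4 _≈ᴹ_
  _≈ᴹ_ : Mat p n → Mat p n → Set
  A ≈ᴹ B = ∀ i j → A i j ≈ₚ B i j

  idM : Mat p n
  idM i j with i Data.Fin.≟ j
  ... | Relation.Nullary.yes _ = 1ₚ
  ... | Relation.Nullary.no  _ = 0ₚ

  IsGL : Mat p n → Set
  IsGL g = Σ (Mat p n) λ h → (g ⊗ h ≈ᴹ idM) × (h ⊗ g ≈ᴹ idM)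

K₂ : (p m : ℕ) → Mat p 2 → Set
K₂ p m g = IsGL g
         × (g (suc zero) zero ≡ₚ 0ₚ [mod^ m ])
         × (g (suc zero) (suc zero) ≡ₚ 1ₚ [mod^ m ])

i0 i1 i2 i3 : Fin 4
i0 = zero
i1 = suc zero
i2 = suc (suc zero)
i3 = suc (suc (suc zero))

Mira : (p m : ℕ) → Mat p 4 → Set
Mira p m g = IsGL g
           × (g i3 i0 ≡ₚ 0ₚ [mod^ m ])
           × (g i3 i1 ≡ₚ 0ₚ [mod^ m ])
           × (g i3 i2 ≡ₚ 0ₚ [mod^ m ])
           × (g i3 i3 ≡ₚ 1ₚ [mod^ m ])

ξ : (p i : ℕ) → Mat p 4
ξ p i r c with r | c
... | suc (suc (suc zero)) | suc zero = fromℤ (+ (p ℕ.^ i))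
... | r' | c' = idM r' c'

ξ⁻¹ : (p i : ℕ) → Mat p 4
ξ⁻¹ p i r c with r | c
... | suc (suc (suc zero)) | suc zero = fromℤ (- (+ (p ℕ.^ i)))
... | r' | c' = idM r' c'

InConj : (p i m : ℕ) → Mat p 4 → Set
InConj p i m g = Σ (Mat p 4) λ k → Mira p m k × (g ≈ᴹ ξ p i ⊗ k ⊗ ξ⁻¹ p i)

InP : ∀ {p} → Mat p 4 → Set
InP g = (g i2 i0 ≈ₚ 0ₚ) × (g i2 i1 ≈ₚ 0ₚ) × (g i3 i0 ≈ₚ 0ₚ) × (g i3 i1 ≈ₚ 0ₚ)

κA κD : ∀ {p} → Mat p 4 → Mat p 2
κA g zero       zero       = g i0 i0
κA g zero       (suc zero) = g i0 i1
κA g (suc zero) zero       = g i1 i0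
κA g (suc zero) (suc zero) = g i1 i1
κD g zero       zero       = g i2 i2
κD g zero       (suc zero) = g i2 i3
κD g (suc zero) zero       = g i3 i2
κD g (suc zero) (suc zero) = g i3 i3

InImage : (p i m : ℕ) → Mat p 2 → Mat p 2 → Set
InImage p i m A D =
  Σ (Mat p 4) λ g → InP g × InConj p i m g × (κA g ≈ᴹ A) × (κD g ≈ᴹ D)

InKK : (p a b : ℕ) → Mat p 2 → Mat p 2 → Set
InKK p a b A D = K₂ p a A × K₂ p b D

module Submission where

-- Write N = n + n' = i + r and P = p^i. Conjugation by ξ changes only the last row: for
-- g = (A B ; 0 D) the last row of ξ⁻¹ g ξ is (entries indexed from 0)
--   (−P a₁₀, P (d₁₁ − P b₁₁ − a₁₁), d₁₀ − P b₁₀, d₁₁ − P b₁₁),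
-- and modulo p^N it must be (0, 0, 0, 1). The last two entries force d₁₀ ≡ 0 and d₁₁ ≡ 1 modulo P,
-- and conversely such a D is matched by a suitable row (b₁₀, b₁₁) of B; given the last entry, the
-- first two then say exactly that a₁₀ ≡ 0 and a₁₁ ≡ 1 modulo p^r. Invertibility passes between g and
-- its diagonal blocks: a block triangular matrix with invertible diagonal blocks is invertible, and
-- conversely the diagonal blocks of an invertible g have one-sided inverses, which for 2 × 2 matrices
-- over a commutative ring are two-sided by Cramer's rule. Everything is checked one level at a time,
-- a p-adic integer being a compatible sequence of integers.

open import Defs
open import Level using (0ℓ)
open import Data.Nat as ℕ using (ℕ; zero; suc; NonZero)
open import Data.Nat.Primality using (Prime; prime⇒nonZero)
import Data.Nat.Properties as ℕ
open import Data.Nat.Divisibility using (_∣_; divides; m∣m*n)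
open import Data.Integer as ℤ using (ℤ; +_; _+_; _*_; _-_; -_; 0ℤ; 1ℤ)
import Data.Integer.Properties as ℤ
open import Data.Integer.Tactic.RingSolver using (solve-∀)
open import Data.Product using (_×_; _,_; proj₁)
open import Relation.Binary.Bundles using (Setoid)
open import Data.Fin using (Fin; zero; suc; _≟_; _↑ˡ_; _↑ʳ_; splitAt; join)
open import Data.Fin.Properties using (splitAt-↑ˡ; splitAt-↑ʳ; join-splitAt)
open import Data.Sum using (_⊎_; inj₁; inj₂)
open import Relation.Nullary using (yes; no)
open import Algebra.Properties.Ring ℤ.+-*-ring using (x[y-z]≈xy-xz)
open import Algebra.Properties.Semiring.Sum ℤ.+-*-semiring
  using (sum-syntax; sum-cong-≗; ∑-comm; ∑-distrib-+; *-distribˡ-sum; *-distribʳ-sum)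
open import Relation.Binary.PropositionalEquality
  using (_≡_; refl; sym; trans; cong; cong₂; subst; module ≡-Reasoning)

-- Defs' congruence wrapped in a record, so that Agda can infer both integers from a proof of it.
infix 4 _≅_[mod_]
record _≅_[mod_] (a b : ℤ) (m : ℕ) : Set where
  constructor wrap
  field unwrap : a ≡ b [mod m ]
open _≅_[mod_] public

module _ {m : ℕ} where

  ≅-reflexive : ∀ {a b} → a ≡ b → a ≅ b [mod m ]
  ≅-reflexive {a} refl = wrap (0ℤ , ℤ.+-inverseʳ a)

  ≅-refl : ∀ {a} → a ≅ a [mod m ]
  ≅-refl = ≅-reflexive refl

  ≅-sym : ∀ {a b} → a ≅ b [mod m ] → b ≅ a [mod m ]
  ≅-sym {a} {b} (wrap (q , e)) = wrap (- q , (begin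
    b - a        ≡⟨ swap-sub a b ⟩
    - (a - b)    ≡⟨ cong -_ e ⟩
    - (q * + m)  ≡⟨ ℤ.neg-distribˡ-* q (+ m) ⟩
    - q * + m    ∎))
    where
    open ≡-Reasoning
    swap-sub : ∀ a b → b - a ≡ - (a - b)
    swap-sub = solve-∀

  ≅-trans : ∀ {a b c} → a ≅ b [mod m ] → b ≅ c [mod m ] → a ≅ c [mod m ]
  ≅-trans {a} {b} {c} (wrap (q , e)) (wrap (r , f)) = wrap (q + r , (begin
    a - c                ≡⟨ split-sub a b c ⟩
    (a - b) + (b - c)    ≡⟨ cong₂ _+_ e f ⟩
    q * + m + r * + m    ≡⟨ ℤ.*-distribʳ-+ (+ m) q r ⟨
    (q + r) * + m        ∎))
    where
    open ≡-Reasoning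
    split-sub : ∀ a b c → a - c ≡ (a - b) + (b - c)
    split-sub = solve-∀

  +-cong-≅ : ∀ {a a' b b'} → a ≅ a' [mod m ] → b ≅ b' [mod m ] → a + b ≅ a' + b' [mod m ]
  +-cong-≅ {a} {a'} {b} {b'} (wrap e) (wrap f) = wrap (+-cong-mod {m} {a'} {a} {b'} {b} e f)

  *-cong-≅ : ∀ {a a' b b'} → a ≅ a' [mod m ] → b ≅ b' [mod m ] → a * b ≅ a' * b' [mod m ]
  *-cong-≅ {a} {a'} {b} {b'} (wrap e) (wrap f) = wrap (*-cong-mod {m} {a'} {a} {b'} {b} e f)

  neg-cong-≅ : ∀ {a a'} → a ≅ a' [mod m ] → - a ≅ - a' [mod m ]
  neg-cong-≅ {a} {a'} (wrap e) = wrap (neg-cong-mod {m} {a'} {a} e)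

  ≅-setoid : Setoid 0ℓ 0ℓ
  ≅-setoid = record
    { Carrier = ℤ
    ; _≈_ = _≅_[mod m ]
    ; isEquivalence = record { refl = ≅-refl ; sym = ≅-sym ; trans = ≅-trans }
    }

≅-∣ : ∀ {d m a b} → d ∣ m → a ≅ b [mod m ] → a ≅ b [mod d ]
≅-∣ {d} {a = a} {b} (divides k refl) (wrap (q , e)) =
  wrap (q * + k , trans e (trans (cong (q *_) (ℤ.pos-* k d)) (sym (ℤ.*-assoc q (+ k) (+ d)))))

private
  swap-factor : ∀ k q n → k * (q * n) ≡ q * (k * n)
  swap-factor = solve-∀

*-scaleˡ-≅ : ∀ k {n a b} → a ≅ b [mod n ] → + k * a ≅ + k * b [mod k ℕ.* n ]
*-scaleˡ-≅ k {n} {a} {b} (wrap (q , e)) = wrap (q , (begin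
  + k * a - + k * b   ≡⟨ x[y-z]≈xy-xz (+ k) a b ⟨
  + k * (a - b)       ≡⟨ cong (+ k *_) e ⟩
  + k * (q * + n)     ≡⟨ swap-factor (+ k) q (+ n) ⟩
  q * (+ k * + n)     ≡⟨ cong (q *_) (ℤ.pos-* k n) ⟨
  q * + (k ℕ.* n)     ∎))
  where open ≡-Reasoning

*-cancelˡ-≅ : ∀ k {n a b} .{{_ : NonZero k}} → + k * a ≅ + k * b [mod k ℕ.* n ] → a ≅ b [mod n ]
*-cancelˡ-≅ k {n} {a} {b} (wrap (q , e)) = wrap (q , ℤ.*-cancelˡ-≡ (+ k) (a - b) (q * + n) (begin
  + k * (a - b)       ≡⟨ x[y-z]≈xy-xz (+ k) a b ⟩
  + k * a - + k * b   ≡⟨ e ⟩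
  q * + (k ℕ.* n)     ≡⟨ cong (q *_) (ℤ.pos-* k n) ⟩
  q * (+ k * + n)     ≡⟨ swap-factor (+ k) q (+ n) ⟨
  + k * (q * + n)     ∎))
  where open ≡-Reasoning

multiple-≅-0 : ∀ k a → + k * a ≅ 0ℤ [mod k ]
multiple-≅-0 k a = wrap (a , trans (ℤ.+-identityʳ (+ k * a)) (ℤ.*-comm (+ k) a))

^-monoʳ-∣ : ∀ p {j N} → j ℕ.≤ N → p ℕ.^ j ∣ p ℕ.^ N
^-monoʳ-∣ p {j} {N} j≤N = divides (p ℕ.^ (N ℕ.∸ j))
  (trans (cong (p ℕ.^_) (sym (ℕ.m∸n+n≡m j≤N))) (ℕ.^-distribˡ-+-* p (N ℕ.∸ j) j))

module _ {p : ℕ} where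

  seq-stable : ∀ (x : ℤₚ p) {j N} → j ℕ.≤ N → seq x N ≅ seq x j [mod p ℕ.^ j ]
  seq-stable x {j} {N} j≤N =
    subst (λ n → seq x n ≅ seq x j [mod p ℕ.^ j ]) (ℕ.m∸n+n≡m j≤N) (stable (N ℕ.∸ j))
    where
    stable : ∀ t → seq x (t ℕ.+ j) ≅ seq x j [mod p ℕ.^ j ]
    stable zero    = ≅-refl
    stable (suc t) = ≅-trans (≅-∣ (^-monoʳ-∣ p (ℕ.m≤n+m j t)) (wrap (compat x (t ℕ.+ j)))) (stable t)

∑-cong-≅ : ∀ {M n} {f g : Fin n → ℤ} → (∀ k → f k ≅ g k [mod M ]) → ∑[ k < n ] f k ≅ ∑[ k < n ] g k [mod M ]
∑-cong-≅ {n = zero}  e = ≅-refl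
∑-cong-≅ {n = suc n} e = +-cong-≅ (e zero) (∑-cong-≅ (λ k → e (suc k)))

ℤMat : ℕ → Set
ℤMat n = Fin n → Fin n → ℤ

module _ {n : ℕ} where

  infixl 7 _·_
  _·_ : ℤMat n → ℤMat n → ℤMat n
  (A · B) i j = ∑[ k < n ] (A i k * B k j)

  δ : ℤMat n
  δ i j with i ≟ j
  ... | yes _ = 1ℤ
  ... | no _  = 0ℤ

  ·-assoc : ∀ A B C i j → ((A · B) · C) i j ≡ (A · (B · C)) i j
  ·-assoc A B C i j = begin
    ∑[ l < n ] (∑[ k < n ] (A i k * B k l) * C l j)
      ≡⟨ sum-cong-≗ (λ l → *-distribʳ-sum (C l j) (λ k → A i k * B k l)) ⟩
    ∑[ l < n ] ∑[ k < n ] (A i k * B k l * C l j)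
      ≡⟨ ∑-comm (λ l k → A i k * B k l * C l j) ⟩
    ∑[ k < n ] ∑[ l < n ] (A i k * B k l * C l j)
      ≡⟨ sum-cong-≗ (λ k → sum-cong-≗ (λ l → ℤ.*-assoc (A i k) (B k l) (C l j))) ⟩
    ∑[ k < n ] ∑[ l < n ] (A i k * (B k l * C l j))
      ≡⟨ sum-cong-≗ (λ k → *-distribˡ-sum (A i k) (λ l → B k l * C l j)) ⟨
    ∑[ k < n ] (A i k * ∑[ l < n ] (B k l * C l j))
      ∎
    where open ≡-Reasoning

  ·-cong-≅ : ∀ {M A A' B B'} → (∀ i j → A i j ≅ A' i j [mod M ]) → (∀ i j → B i j ≅ B' i j [mod M ]) →
             ∀ i j → (A · B) i j ≅ (A' · B') i j [mod M ]
  ·-cong-≅ eA eB i j = ∑-cong-≅ (λ k → *-cong-≅ (eA i k) (eB k j))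

δ-suc : ∀ {n} (i j : Fin n) → δ (suc i) (suc j) ≡ δ i j
δ-suc i j with i ≟ j
... | yes _ = refl
... | no _  = refl

∑-zero : ∀ n (f : Fin n → ℤ) → ∑[ k < n ] (0ℤ * f k) ≡ 0ℤ
∑-zero zero    f = refl
∑-zero (suc n) f = trans (ℤ.+-identityˡ _) (∑-zero n (λ k → f (suc k)))

∑-neg : ∀ n (f : Fin n → ℤ) → ∑[ k < n ] (- f k) ≡ - (∑[ k < n ] f k)
∑-neg zero    f = refl
∑-neg (suc n) f = trans (cong (λ s → - f zero + s) (∑-neg n (λ k → f (suc k))))
                        (sym (ℤ.neg-distrib-+ (f zero) (∑[ k < n ] f (suc k))))

∑-δˡ : ∀ {n} i (x : Fin n → ℤ) → ∑[ k < n ] (δ i k * x k) ≡ x i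
∑-δˡ {suc n} zero x = begin
  1ℤ * x zero + ∑[ k < n ] (0ℤ * x (suc k))  ≡⟨ cong₂ _+_ (ℤ.*-identityˡ (x zero)) (∑-zero n (λ k → x (suc k))) ⟩
  x zero + 0ℤ                                ≡⟨ ℤ.+-identityʳ (x zero) ⟩
  x zero                                     ∎
  where open ≡-Reasoning
∑-δˡ {suc n} (suc i) x = begin
  0ℤ * x zero + ∑[ k < n ] (δ (suc i) (suc k) * x (suc k))
    ≡⟨ cong (λ s → 0ℤ * x zero + s) (sum-cong-≗ (λ k → cong (_* x (suc k)) (δ-suc i k))) ⟩
  0ℤ + ∑[ k < n ] (δ i k * x (suc k))
    ≡⟨ ℤ.+-identityˡ _ ⟩
  ∑[ k < n ] (δ i k * x (suc k))
    ≡⟨ ∑-δˡ i (λ k → x (suc k)) ⟩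
  x (suc i) ∎
  where open ≡-Reasoning

δ-sym : ∀ {n} (i j : Fin n) → δ i j ≡ δ j i
δ-sym zero    zero    = refl
δ-sym zero    (suc j) = refl
δ-sym (suc i) zero    = refl
δ-sym (suc i) (suc j) = trans (δ-suc i j) (trans (δ-sym i j) (sym (δ-suc j i)))

∑-δʳ : ∀ {n} j (x : Fin n → ℤ) → ∑[ k < n ] (x k * δ k j) ≡ x j
∑-δʳ j x = trans (sum-cong-≗ (λ k → trans (ℤ.*-comm (x k) (δ k j)) (cong (_* x k) (δ-sym k j)))) (∑-δˡ j x)

·-identityˡ : ∀ {n} (A : ℤMat n) i j → (δ · A) i j ≡ A i j
·-identityˡ A i j = ∑-δˡ i (λ k → A k j)

·-identityʳ : ∀ {n} (A : ℤMat n) i j → (A · δ) i j ≡ A i j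
·-identityʳ A i j = ∑-δʳ j (A i)

·-scaleˡ : ∀ {n} c (A B : ℤMat n) i j → c * (A · B) i j ≡ ((λ i k → c * A i k) · B) i j
·-scaleˡ {n} c A B i j = begin
  c * ∑[ k < n ] (A i k * B k j)    ≡⟨ *-distribˡ-sum c (λ k → A i k * B k j) ⟩
  ∑[ k < n ] (c * (A i k * B k j))  ≡⟨ sum-cong-≗ (λ k → ℤ.*-assoc c (A i k) (B k j)) ⟨
  ∑[ k < n ] (c * A i k * B k j)    ∎
  where open ≡-Reasoning

≅-cancel-unit : ∀ {M} u v {x y} → u * v ≅ 1ℤ [mod M ] → v * x ≅ v * y [mod M ] → x ≅ y [mod M ]
≅-cancel-unit {M} u v {x} {y} uv≅1 vx≅vy = begin
  x            ≡⟨ ℤ.*-identityˡ x ⟨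
  1ℤ * x       ≈⟨ *-cong-≅ uv≅1 (≅-refl {a = x}) ⟨
  u * v * x    ≡⟨ ℤ.*-assoc u v x ⟩
  u * (v * x)  ≈⟨ *-cong-≅ (≅-refl {a = u}) vx≅vy ⟩
  u * (v * y)  ≡⟨ ℤ.*-assoc u v y ⟨
  u * v * y    ≈⟨ *-cong-≅ uv≅1 (≅-refl {a = y}) ⟩
  1ℤ * y       ≡⟨ ℤ.*-identityˡ y ⟩
  y            ∎
  where open import Relation.Binary.Reasoning.Setoid (≅-setoid {M})

i0₂ i1₂ : Fin 2
i0₂ = zero
i1₂ = suc zero

det : ℤMat 2 → ℤ
det A = A i0₂ i0₂ * A i1₂ i1₂ - A i0₂ i1₂ * A i1₂ i0₂

adj : ℤMat 2 → ℤMat 2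
adj A zero       zero       = A i1₂ i1₂
adj A zero       (suc zero) = - A i0₂ i1₂
adj A (suc zero) zero       = - A i1₂ i0₂
adj A (suc zero) (suc zero) = A i0₂ i0₂

det-· : ∀ A B → det (A · B) ≡ det A * det B
det-· A B =
  identity (A i0₂ i0₂) (A i0₂ i1₂) (A i1₂ i0₂) (A i1₂ i1₂) (B i0₂ i0₂) (B i0₂ i1₂) (B i1₂ i0₂) (B i1₂ i1₂)
  where
  identity : ∀ a b c d e f g h →
    (a * e + (b * g + 0ℤ)) * (c * f + (d * h + 0ℤ)) - (a * f + (b * h + 0ℤ)) * (c * e + (d * g + 0ℤ))
    ≡ (a * d - b * c) * (e * h - f * g)
  identity = solve-∀

adj-· : ∀ A i j → (adj A · A) i j ≡ det A * δ i j
adj-· A zero       zero       = e₀₀ (A i0₂ i0₂) (A i0₂ i1₂) (A i1₂ i0₂) (A i1₂ i1₂)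
  where
  e₀₀ : ∀ a b c d → d * a + (- b * c + 0ℤ) ≡ (a * d - b * c) * 1ℤ
  e₀₀ = solve-∀
adj-· A zero       (suc zero) = e₀₁ (A i0₂ i0₂) (A i0₂ i1₂) (A i1₂ i0₂) (A i1₂ i1₂)
  where
  e₀₁ : ∀ a b c d → d * b + (- b * d + 0ℤ) ≡ (a * d - b * c) * 0ℤ
  e₀₁ = solve-∀
adj-· A (suc zero) zero       = e₁₀ (A i0₂ i0₂) (A i0₂ i1₂) (A i1₂ i0₂) (A i1₂ i1₂)
  where
  e₁₀ : ∀ a b c d → - c * a + (a * c + 0ℤ) ≡ (a * d - b * c) * 0ℤ
  e₁₀ = solve-∀
adj-· A (suc zero) (suc zero) = e₁₁ (A i0₂ i0₂) (A i0₂ i1₂) (A i1₂ i0₂) (A i1₂ i1₂)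
  where
  e₁₁ : ∀ a b c d → - c * b + (a * d + 0ℤ) ≡ (a * d - b * c) * 1ℤ
  e₁₁ = solve-∀

det-cong : ∀ {M A A'} → (∀ i j → A i j ≅ A' i j [mod M ]) → det A ≅ det A' [mod M ]
det-cong e = +-cong-≅ (*-cong-≅ (e i0₂ i0₂) (e i1₂ i1₂)) (neg-cong-≅ (*-cong-≅ (e i0₂ i1₂) (e i1₂ i0₂)))

-- Cramer's rule gives det A • B ≅ adj A, and det A is a unit, so B · A ≅ 1 after cancelling det A.
·-inverseʳ⇒inverseˡ : ∀ {M} (A B : ℤMat 2) → (∀ i j → (A · B) i j ≅ δ i j [mod M ]) →
                      ∀ i j → (B · A) i j ≅ δ i j [mod M ]
·-inverseʳ⇒inverseˡ {M} A B AB≅δ i j = ≅-cancel-unit (det B) (det A) unit (begin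
  det A * (B · A) i j                ≡⟨ ·-scaleˡ (det A) B A i j ⟩
  ((λ i k → det A * B i k) · A) i j  ≈⟨ ·-cong-≅ {B = A} scaled-B≅adj (λ _ _ → ≅-refl) i j ⟩
  (adj A · A) i j                    ≡⟨ adj-· A i j ⟩
  det A * δ i j                      ∎)
  where
  open import Relation.Binary.Reasoning.Setoid (≅-setoid {M})

  unit : det B * det A ≅ 1ℤ [mod M ]
  unit = begin
    det B * det A  ≡⟨ ℤ.*-comm (det B) (det A) ⟩
    det A * det B  ≡⟨ det-· A B ⟨
    det (A · B)    ≈⟨ det-cong AB≅δ ⟩
    det δ          ≡⟨⟩
    1ℤ             ∎

  scaled-B≅adj : ∀ i k → det A * B i k ≅ adj A i k [mod M ]
  scaled-B≅adj i k = begin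
    det A * B i k                      ≡⟨ cong (det A *_) (·-identityˡ B i k) ⟨
    det A * (δ · B) i k                ≡⟨ ·-scaleˡ (det A) δ B i k ⟩
    ((λ i l → det A * δ i l) · B) i k  ≡⟨ sum-cong-≗ (λ l → cong (_* B l k) (adj-· A i l)) ⟨
    ((adj A · A) · B) i k              ≡⟨ ·-assoc (adj A) A B i k ⟩
    (adj A · (A · B)) i k              ≈⟨ ·-cong-≅ {A = adj A} (λ _ _ → ≅-refl) AB≅δ i k ⟩
    (adj A · δ) i k                    ≡⟨ ·-identityʳ (adj A) i k ⟩
    adj A i k                          ∎

module _ {p n : ℕ} where

  level : ℕ → Mat p n → ℤMat n
  level m X i j = seq (X i j) m

  level-sumFin : ∀ {k} (f : Fin k → ℤₚ p) m → seq (sumFin k f) m ≡ ∑[ l < k ] seq (f l) m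
  level-sumFin {zero}  f m = refl
  level-sumFin {suc k} f m = cong (λ s → seq (f zero) m + s) (level-sumFin (λ l → f (suc l)) m)

  level-⊗ : ∀ m (X Y : Mat p n) i j → level m (X ⊗ Y) i j ≡ (level m X · level m Y) i j
  level-⊗ m X Y i j = level-sumFin (λ k → X i k *ₚ Y k j) m

  level-idM : ∀ m i j → level m idM i j ≡ δ i j
  level-idM m i j with i ≟ j
  ... | yes _ = refl
  ... | no _  = refl

-- Likewise Defs' equality of p-adic matrices. Implicit matrix arguments occurring under ⊗ or ⊕ are
-- passed explicitly throughout: inferring them would make Agda unfold these operations.
infix 4 _≃_
record _≃_ {p n} (X Y : Mat p n) : Set where
  constructor levelwise
  field at : ∀ m i j → level m X i j ≅ level m Y i j [mod p ℕ.^ m ]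
open _≃_ public

module _ {p n : ℕ} where

  ≃⇒≈ᴹ : ∀ {X Y : Mat p n} → X ≃ Y → X ≈ᴹ Y
  ≃⇒≈ᴹ e i j m = unwrap (at e m i j)

  ≈ᴹ⇒≃ : ∀ {X Y : Mat p n} → X ≈ᴹ Y → X ≃ Y
  ≈ᴹ⇒≃ e = levelwise λ m i j → wrap (e i j m)

  exactly : ∀ {X Y : Mat p n} → (∀ m i j → level m X i j ≡ level m Y i j) → X ≃ Y
  exactly e = levelwise λ m i j → ≅-reflexive (e m i j)

  ≃-refl : ∀ {X : Mat p n} → X ≃ X
  ≃-refl = levelwise λ m i j → ≅-refl

  ≃-sym : ∀ {X Y : Mat p n} → X ≃ Y → Y ≃ X
  ≃-sym e = levelwise λ m i j → ≅-sym (at e m i j)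

  ≃-trans : ∀ {X Y Z : Mat p n} → X ≃ Y → Y ≃ Z → X ≃ Z
  ≃-trans e f = levelwise λ m i j → ≅-trans (at e m i j) (at f m i j)

  ≃-setoid : Setoid 0ℓ 0ℓ
  ≃-setoid = record
    { Carrier = Mat p n ; _≈_ = _≃_ ; isEquivalence = record { refl = ≃-refl ; sym = ≃-sym ; trans = ≃-trans } }

  infixl 6 _⊕_
  _⊕_ : Mat p n → Mat p n → Mat p n
  (X ⊕ Y) i j = X i j +ₚ Y i j

  ⊖_ : Mat p n → Mat p n
  (⊖ X) i j = -ₚ X i j

  0ᴹ : Mat p n
  0ᴹ i j = 0ₚ

  ⊕-cong : ∀ {X X' Y Y' : Mat p n} → X ≃ X' → Y ≃ Y' → X ⊕ Y ≃ X' ⊕ Y'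
  ⊕-cong e f = levelwise λ m i j → +-cong-≅ (at e m i j) (at f m i j)

  ⊕-congˡ : ∀ X {Y Z : Mat p n} → Y ≃ Z → X ⊕ Y ≃ X ⊕ Z
  ⊕-congˡ X {Y} {Z} = ⊕-cong {X = X} {X} {Y} {Z} ≃-refl

  ⊕-congʳ : ∀ X {Y Z : Mat p n} → Y ≃ Z → Y ⊕ X ≃ Z ⊕ X
  ⊕-congʳ X {Y} {Z} e = ⊕-cong {X = Y} {Z} {X} {X} e ≃-refl

  ⊖-cong : ∀ {X X' : Mat p n} → X ≃ X' → ⊖ X ≃ ⊖ X'
  ⊖-cong e = levelwise λ m i j → neg-cong-≅ (at e m i j)

  ⊕-identityʳ : ∀ X → X ⊕ 0ᴹ ≃ X
  ⊕-identityʳ X = exactly λ m i j → ℤ.+-identityʳ (level m X i j)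

  ⊕-identityˡ : ∀ X → 0ᴹ ⊕ X ≃ X
  ⊕-identityˡ X = exactly λ m i j → ℤ.+-identityˡ (level m X i j)

  ⊖-inverseˡ : ∀ X → ⊖ X ⊕ X ≃ 0ᴹ
  ⊖-inverseˡ X = exactly λ m i j → ℤ.+-inverseˡ (level m X i j)

  ⊖-inverseʳ : ∀ X → X ⊕ ⊖ X ≃ 0ᴹ
  ⊖-inverseʳ X = exactly λ m i j → ℤ.+-inverseʳ (level m X i j)

  ⊗-cong : ∀ {X X' Y Y' : Mat p n} → X ≃ X' → Y ≃ Y' → X ⊗ Y ≃ X' ⊗ Y'
  ⊗-cong {X} {X'} {Y} {Y'} e f = levelwise step
    where
    step : ∀ m i j → level m (X ⊗ Y) i j ≅ level m (X' ⊗ Y') i j [mod p ℕ.^ m ]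
    step m i j = begin
      level m (X ⊗ Y) i j              ≡⟨ level-⊗ m X Y i j ⟩
      (level m X · level m Y) i j      ≈⟨ ·-cong-≅ (at e m) (at f m) i j ⟩
      (level m X' · level m Y') i j    ≡⟨ level-⊗ m X' Y' i j ⟨
      level m (X' ⊗ Y') i j            ∎
      where open import Relation.Binary.Reasoning.Setoid (≅-setoid {p ℕ.^ m})

  ⊗-congˡ : ∀ X {Y Z : Mat p n} → Y ≃ Z → X ⊗ Y ≃ X ⊗ Z
  ⊗-congˡ X = ⊗-cong (≃-refl {X})

  ⊗-congʳ : ∀ X {Y Z : Mat p n} → Y ≃ Z → Y ⊗ X ≃ Z ⊗ X
  ⊗-congʳ X e = ⊗-cong e (≃-refl {X})

  ⊗-assoc : ∀ X Y Z → (X ⊗ Y) ⊗ Z ≃ X ⊗ (Y ⊗ Z)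
  ⊗-assoc X Y Z = exactly λ m i j → begin
    level m ((X ⊗ Y) ⊗ Z) i j                      ≡⟨ level-⊗ m (X ⊗ Y) Z i j ⟩
    (level m (X ⊗ Y) · level m Z) i j              ≡⟨ sum-cong-≗ (λ k → cong (_* level m Z k j) (level-⊗ m X Y i k)) ⟩
    ((level m X · level m Y) · level m Z) i j      ≡⟨ ·-assoc (level m X) (level m Y) (level m Z) i j ⟩
    (level m X · (level m Y · level m Z)) i j      ≡⟨ sum-cong-≗ (λ k → cong (level m X i k *_) (level-⊗ m Y Z k j)) ⟨
    (level m X · level m (Y ⊗ Z)) i j              ≡⟨ level-⊗ m X (Y ⊗ Z) i j ⟨
    level m (X ⊗ (Y ⊗ Z)) i j                      ∎
    where open ≡-Reasoning

  ⊗-identityˡ : ∀ X → idM ⊗ X ≃ X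
  ⊗-identityˡ X = exactly λ m i j → begin
    level m (idM ⊗ X) i j          ≡⟨ level-⊗ m idM X i j ⟩
    (level m idM · level m X) i j  ≡⟨ sum-cong-≗ (λ k → cong (_* level m X k j) (level-idM m i k)) ⟩
    (δ · level m X) i j            ≡⟨ ·-identityˡ (level m X) i j ⟩
    level m X i j                  ∎
    where open ≡-Reasoning

  ⊗-identityʳ : ∀ X → X ⊗ idM ≃ X
  ⊗-identityʳ X = exactly λ m i j → begin
    level m (X ⊗ idM) i j          ≡⟨ level-⊗ m X idM i j ⟩
    (level m X · level m idM) i j  ≡⟨ sum-cong-≗ (λ k → cong (level m X i k *_) (level-idM m k j)) ⟩
    (level m X · δ) i j            ≡⟨ ·-identityʳ (level m X) i j ⟩
    level m X i j                  ∎
    where open ≡-Reasoning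

  ⊗-zeroˡ : ∀ X → 0ᴹ ⊗ X ≃ 0ᴹ
  ⊗-zeroˡ X = exactly λ m i j → trans (level-⊗ m 0ᴹ X i j) (∑-zero n (λ k → level m X k j))

  ⊗-zeroʳ : ∀ X → X ⊗ 0ᴹ ≃ 0ᴹ
  ⊗-zeroʳ X = exactly λ m i j → trans (level-⊗ m X 0ᴹ i j)
    (trans (sum-cong-≗ (λ k → trans (ℤ.*-comm (level m X i k) 0ℤ) refl)) (∑-zero n (λ k → level m X i k)))

  ⊗-⊖ʳ : ∀ X Y → X ⊗ ⊖ Y ≃ ⊖ (X ⊗ Y)
  ⊗-⊖ʳ X Y = exactly λ m i j → begin
    level m (X ⊗ ⊖ Y) i j                          ≡⟨ level-⊗ m X (⊖ Y) i j ⟩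
    ∑[ k < n ] (level m X i k * - level m Y k j)
      ≡⟨ sum-cong-≗ (λ k → ℤ.neg-distribʳ-* (level m X i k) (level m Y k j)) ⟨
    ∑[ k < n ] (- (level m X i k * level m Y k j)) ≡⟨ ∑-neg n (λ k → level m X i k * level m Y k j) ⟩
    - ((level m X · level m Y) i j)                ≡⟨ cong -_ (level-⊗ m X Y i j) ⟨
    level m (⊖ (X ⊗ Y)) i j                        ∎
    where open ≡-Reasoning

  ⊖-⊗ˡ : ∀ X Y → ⊖ X ⊗ Y ≃ ⊖ (X ⊗ Y)
  ⊖-⊗ˡ X Y = exactly λ m i j → begin
    level m (⊖ X ⊗ Y) i j                          ≡⟨ level-⊗ m (⊖ X) Y i j ⟩
    ∑[ k < n ] (- level m X i k * level m Y k j)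
      ≡⟨ sum-cong-≗ (λ k → ℤ.neg-distribˡ-* (level m X i k) (level m Y k j)) ⟨
    ∑[ k < n ] (- (level m X i k * level m Y k j)) ≡⟨ ∑-neg n (λ k → level m X i k * level m Y k j) ⟩
    - ((level m X · level m Y) i j)                ≡⟨ cong -_ (level-⊗ m X Y i j) ⟨
    level m (⊖ (X ⊗ Y)) i j                        ∎
    where open ≡-Reasoning

  ⊗-inverse : ∀ {X X' Y Y' : Mat p n} → X ⊗ X' ≃ idM → Y ⊗ Y' ≃ idM → (X ⊗ Y) ⊗ (Y' ⊗ X') ≃ idM
  ⊗-inverse {X} {X'} {Y} {Y'} XX' YY' = begin
    (X ⊗ Y) ⊗ (Y' ⊗ X')  ≈⟨ ⊗-assoc X Y (Y' ⊗ X') ⟩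
    X ⊗ (Y ⊗ (Y' ⊗ X'))  ≈⟨ ⊗-congˡ X {(Y ⊗ Y') ⊗ X'} {Y ⊗ (Y' ⊗ X')} (⊗-assoc Y Y' X') ⟨
    X ⊗ ((Y ⊗ Y') ⊗ X')  ≈⟨ ⊗-congˡ X {(Y ⊗ Y') ⊗ X'} {idM ⊗ X'} (⊗-congʳ X' {Y ⊗ Y'} {idM} YY') ⟩
    X ⊗ (idM ⊗ X')       ≈⟨ ⊗-congˡ X {idM ⊗ X'} {X'} (⊗-identityˡ X') ⟩
    X ⊗ X'               ≈⟨ XX' ⟩
    idM                  ∎
    where open import Relation.Binary.Reasoning.Setoid ≃-setoid

  ⊗-cancelˡ : ∀ {X X' : Mat p n} Y → X' ⊗ X ≃ idM → X' ⊗ (X ⊗ Y) ≃ Y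
  ⊗-cancelˡ {X} {X'} Y X'X = begin
    X' ⊗ (X ⊗ Y)  ≈⟨ ⊗-assoc X' X Y ⟨
    (X' ⊗ X) ⊗ Y  ≈⟨ ⊗-congʳ Y {X' ⊗ X} {idM} X'X ⟩
    idM ⊗ Y       ≈⟨ ⊗-identityˡ Y ⟩
    Y             ∎
    where open import Relation.Binary.Reasoning.Setoid ≃-setoid

  ⊗-cancelʳ : ∀ {X X' : Mat p n} Y → X ⊗ X' ≃ idM → (Y ⊗ X) ⊗ X' ≃ Y
  ⊗-cancelʳ {X} {X'} Y XX' = begin
    (Y ⊗ X) ⊗ X'  ≈⟨ ⊗-assoc Y X X' ⟩
    Y ⊗ (X ⊗ X')  ≈⟨ ⊗-congˡ Y {X ⊗ X'} {idM} XX' ⟩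
    Y ⊗ idM       ≈⟨ ⊗-identityʳ Y ⟩
    Y             ∎
    where open import Relation.Binary.Reasoning.Setoid ≃-setoid

  ⊗-conjugate-cancel : ∀ {X X' : Mat p n} K → X' ⊗ X ≃ idM → X' ⊗ (X ⊗ K ⊗ X') ⊗ X ≃ K
  ⊗-conjugate-cancel {X} {X'} K X'X = begin
    X' ⊗ (X ⊗ K ⊗ X') ⊗ X    ≈⟨ ⊗-congʳ X {X' ⊗ (X ⊗ K) ⊗ X'} {X' ⊗ (X ⊗ K ⊗ X')}
                                  (⊗-assoc X' (X ⊗ K) X') ⟨
    X' ⊗ (X ⊗ K) ⊗ X' ⊗ X    ≈⟨ ⊗-congʳ X {X' ⊗ (X ⊗ K) ⊗ X'} {K ⊗ X'}
                                  (⊗-congʳ X' {X' ⊗ (X ⊗ K)} {K} (⊗-cancelˡ {X} {X'} K X'X)) ⟩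
    K ⊗ X' ⊗ X               ≈⟨ ⊗-cancelʳ {X'} {X} K X'X ⟩
    K                        ∎
    where open import Relation.Binary.Reasoning.Setoid ≃-setoid

  IsGL-intro : ∀ {X : Mat p n} Y → X ⊗ Y ≃ idM → Y ⊗ X ≃ idM → IsGL X
  IsGL-intro {X} Y XY YX = Y , ≃⇒≈ᴹ {X ⊗ Y} {idM} XY , ≃⇒≈ᴹ {Y ⊗ X} {idM} YX

  IsGL-inverseʳ : ∀ {X : Mat p n} (gl : IsGL X) → X ⊗ proj₁ gl ≃ idM
  IsGL-inverseʳ {X} (Y , XY , _) = ≈ᴹ⇒≃ {X ⊗ Y} {idM} XY

  IsGL-inverseˡ : ∀ {X : Mat p n} (gl : IsGL X) → proj₁ gl ⊗ X ≃ idM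
  IsGL-inverseˡ {X} (Y , _ , YX) = ≈ᴹ⇒≃ {Y ⊗ X} {idM} YX

  IsGL-⊗ : ∀ {X Y : Mat p n} → IsGL X → IsGL Y → IsGL (X ⊗ Y)
  IsGL-⊗ {X} {Y} glX@(X⁻¹ , _) glY@(Y⁻¹ , _) = IsGL-intro {X ⊗ Y} (Y⁻¹ ⊗ X⁻¹)
    (⊗-inverse {X} {X⁻¹} {Y} {Y⁻¹} (IsGL-inverseʳ {X} glX) (IsGL-inverseʳ {Y} glY))
    (⊗-inverse {Y⁻¹} {Y} {X⁻¹} {X} (IsGL-inverseˡ {Y} glY) (IsGL-inverseˡ {X} glX))

  IsGL-resp : ∀ {X Y : Mat p n} → X ≃ Y → IsGL X → IsGL Y
  IsGL-resp {X} {Y} X≃Y glX@(X⁻¹ , _) = IsGL-intro {Y} X⁻¹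
    (≃-trans (⊗-congʳ X⁻¹ {Y} {X} (≃-sym X≃Y)) (IsGL-inverseʳ {X} glX))
    (≃-trans (⊗-congˡ X⁻¹ {Y} {X} (≃-sym X≃Y)) (IsGL-inverseˡ {X} glX))

⊗-inverseʳ⇒inverseˡ : ∀ {p} (X Y : Mat p 2) → X ⊗ Y ≃ idM → Y ⊗ X ≃ idM
⊗-inverseʳ⇒inverseˡ {p} X Y XY≃1 = levelwise YX≅1
  where
  levelXY≅δ : ∀ m i j → (level m X · level m Y) i j ≅ δ i j [mod p ℕ.^ m ]
  levelXY≅δ m i j =
    ≅-trans (≅-reflexive (sym (level-⊗ m X Y i j))) (≅-trans (at XY≃1 m i j) (≅-reflexive (level-idM m i j)))

  YX≅1 : ∀ m i j → level m (Y ⊗ X) i j ≅ level m idM i j [mod p ℕ.^ m ]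
  YX≅1 m i j = begin
    level m (Y ⊗ X) i j          ≡⟨ level-⊗ m Y X i j ⟩
    (level m Y · level m X) i j  ≈⟨ ·-inverseʳ⇒inverseˡ (level m X) (level m Y) (levelXY≅δ m) i j ⟩
    δ i j                        ≡⟨ level-idM m i j ⟨
    level m idM i j              ∎
    where open import Relation.Binary.Reasoning.Setoid (≅-setoid {p ℕ.^ m})

IsGL-fromʳ : ∀ {p} {X Y : Mat p 2} → X ⊗ Y ≃ idM → IsGL X
IsGL-fromʳ {X = X} {Y} XY≃1 = IsGL-intro {X = X} Y XY≃1 (⊗-inverseʳ⇒inverseˡ X Y XY≃1)

IsGL-fromˡ : ∀ {p} {X Y : Mat p 2} → Y ⊗ X ≃ idM → IsGL X
IsGL-fromˡ {X = X} {Y} YX≃1 = IsGL-intro {X = X} Y (⊗-inverseʳ⇒inverseˡ Y X YX≃1) YX≃1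

up down : Fin 2 → Fin 4
up a = a ↑ˡ 2
down a = 2 ↑ʳ a

module _ {p : ℕ} where

  block : (Fin 2 → Fin 4) → (Fin 2 → Fin 4) → Mat p 4 → Mat p 2
  block r c G a b = G (r a) (c b)

  blockEntry : (A B C D : Mat p 2) → Fin 2 ⊎ Fin 2 → Fin 2 ⊎ Fin 2 → ℤₚ p
  blockEntry A B C D (inj₁ a) (inj₁ b) = A a b
  blockEntry A B C D (inj₁ a) (inj₂ b) = B a b
  blockEntry A B C D (inj₂ a) (inj₁ b) = C a b
  blockEntry A B C D (inj₂ a) (inj₂ b) = D a b

  blocks : (A B C D : Mat p 2) → Mat p 4
  blocks A B C D r c = blockEntry A B C D (splitAt 2 r) (splitAt 2 c)

  block-⊗ : ∀ r c (G H : Mat p 4) → block r c (G ⊗ H) ≃ block r up G ⊗ block up c H ⊕ block r down G ⊗ block down c H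
  block-⊗ r c G H = exactly λ m a b →
    split (level m G (r a) i0 * level m H i0 (c b)) (level m G (r a) i1 * level m H i1 (c b))
          (level m G (r a) i2 * level m H i2 (c b)) (level m G (r a) i3 * level m H i3 (c b))
    where
    split : ∀ w x y z → w + (x + (y + (z + 0ℤ))) ≡ (w + (x + 0ℤ)) + (y + (z + 0ℤ))
    split = solve-∀

  module _ {A B C D : Mat p 2} where

    block-up-up : block up up (blocks A B C D) ≃ A
    block-up-up = exactly λ m a b →
      cong (λ x → seq x m) (cong₂ (blockEntry A B C D) (splitAt-↑ˡ 2 a 2) (splitAt-↑ˡ 2 b 2))

    block-up-down : block up down (blocks A B C D) ≃ B
    block-up-down = exactly λ m a b →
      cong (λ x → seq x m) (cong₂ (blockEntry A B C D) (splitAt-↑ˡ 2 a 2) (splitAt-↑ʳ 2 2 b))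

    block-down-up : block down up (blocks A B C D) ≃ C
    block-down-up = exactly λ m a b →
      cong (λ x → seq x m) (cong₂ (blockEntry A B C D) (splitAt-↑ʳ 2 2 a) (splitAt-↑ˡ 2 b 2))

    block-down-down : block down down (blocks A B C D) ≃ D
    block-down-down = exactly λ m a b →
      cong (λ x → seq x m) (cong₂ (blockEntry A B C D) (splitAt-↑ʳ 2 2 a) (splitAt-↑ʳ 2 2 b))

  ≃-blocks : ∀ G → G ≃ blocks (block up up G) (block up down G) (block down up G) (block down down G)
  ≃-blocks G = exactly λ m r c → cong (λ x → seq x m) (trans
    (cong₂ G (sym (join-splitAt 2 2 r)) (sym (join-splitAt 2 2 c))) (joined (splitAt 2 r) (splitAt 2 c)))
    where
    joined : ∀ s t → G (join 2 2 s) (join 2 2 t)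
                   ≡ blockEntry (block up up G) (block up down G) (block down up G) (block down down G) s t
    joined (inj₁ a) (inj₁ b) = refl
    joined (inj₁ a) (inj₂ b) = refl
    joined (inj₂ a) (inj₁ b) = refl
    joined (inj₂ a) (inj₂ b) = refl

  blocks-cong : ∀ {A A' B B' C C' D D' : Mat p 2} → A ≃ A' → B ≃ B' → C ≃ C' → D ≃ D' →
                blocks A B C D ≃ blocks A' B' C' D'
  blocks-cong {A} {A'} {B} {B'} {C} {C'} {D} {D'} eA eB eC eD =
    levelwise λ m r c → entry m (splitAt 2 r) (splitAt 2 c)
    where
    entry : ∀ m s t → seq (blockEntry A B C D s t) m ≅ seq (blockEntry A' B' C' D' s t) m [mod p ℕ.^ m ]
    entry m (inj₁ a) (inj₁ b) = at eA m a b
    entry m (inj₁ a) (inj₂ b) = at eB m a b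
    entry m (inj₂ a) (inj₁ b) = at eC m a b
    entry m (inj₂ a) (inj₂ b) = at eD m a b

  block-⊗-≃ : ∀ r c (G H : Mat p 4) {X Y Z W} → block r up G ≃ X → block up c H ≃ Y →
              block r down G ≃ Z → block down c H ≃ W → block r c (G ⊗ H) ≃ X ⊗ Y ⊕ Z ⊗ W
  block-⊗-≃ r c G H {X} {Y} {Z} {W} e₁ e₂ e₃ e₄ = ≃-trans (block-⊗ r c G H)
    (⊕-cong {X = block r up G ⊗ block up c H} {X ⊗ Y} {block r down G ⊗ block down c H} {Z ⊗ W}
      (⊗-cong {X = block r up G} {X} {block up c H} {Y} e₁ e₂)
      (⊗-cong {X = block r down G} {Z} {block down c H} {W} e₃ e₄))

  ⌈_,_,_⌉ : Mat p 2 → Mat p 2 → Mat p 2 → Mat p 4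
  ⌈ A , B , D ⌉ = blocks A B 0ᴹ D

  ⌈⌉-⊗ : ∀ A B D A' B' D' → ⌈ A , B , D ⌉ ⊗ ⌈ A' , B' , D' ⌉ ≃ ⌈ A ⊗ A' , A ⊗ B' ⊕ B ⊗ D' , D ⊗ D' ⌉
  ⌈⌉-⊗ A B D A' B' D' = ≃-trans (≃-blocks (⌈ A , B , D ⌉ ⊗ ⌈ A' , B' , D' ⌉)) (blocks-cong
    {block up up (⌈ A , B , D ⌉ ⊗ ⌈ A' , B' , D' ⌉)} {A ⊗ A'}
    {block up down (⌈ A , B , D ⌉ ⊗ ⌈ A' , B' , D' ⌉)} {A ⊗ B' ⊕ B ⊗ D'}
    {block down up (⌈ A , B , D ⌉ ⊗ ⌈ A' , B' , D' ⌉)} {0ᴹ}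
    {block down down (⌈ A , B , D ⌉ ⊗ ⌈ A' , B' , D' ⌉)} {D ⊗ D'}
    (≃-trans (block-⊗-≃ up up ⌈ A , B , D ⌉ ⌈ A' , B' , D' ⌉ {A} {A'} {B} {0ᴹ} ↑↑ ↑↑' ↑↓ ↓↑')
      (≃-trans (⊕-congˡ (A ⊗ A') {B ⊗ 0ᴹ} {0ᴹ} (⊗-zeroʳ B)) (⊕-identityʳ (A ⊗ A'))))
    (block-⊗-≃ up down ⌈ A , B , D ⌉ ⌈ A' , B' , D' ⌉ {A} {B'} {B} {D'} ↑↑ ↑↓' ↑↓ ↓↓')
    (≃-trans (block-⊗-≃ down up ⌈ A , B , D ⌉ ⌈ A' , B' , D' ⌉ {0ᴹ} {A'} {D} {0ᴹ} ↓↑ ↑↑' ↓↓ ↓↑')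
      (≃-trans (⊕-cong {X = 0ᴹ ⊗ A'} {0ᴹ} {D ⊗ 0ᴹ} {0ᴹ} (⊗-zeroˡ A') (⊗-zeroʳ D)) (⊕-identityʳ 0ᴹ)))
    (≃-trans (block-⊗-≃ down down ⌈ A , B , D ⌉ ⌈ A' , B' , D' ⌉ {0ᴹ} {B'} {D} {D'} ↓↑ ↑↓' ↓↓ ↓↓')
      (≃-trans (⊕-congʳ (D ⊗ D') {0ᴹ ⊗ B'} {0ᴹ} (⊗-zeroˡ B')) (⊕-identityˡ (D ⊗ D')))))
    where
    ↑↑ = block-up-up {A} {B} {0ᴹ} {D}
    ↑↓ = block-up-down {A} {B} {0ᴹ} {D}
    ↓↑ = block-down-up {A} {B} {0ᴹ} {D}
    ↓↓ = block-down-down {A} {B} {0ᴹ} {D}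
    ↑↑' = block-up-up {A'} {B'} {0ᴹ} {D'}
    ↑↓' = block-up-down {A'} {B'} {0ᴹ} {D'}
    ↓↑' = block-down-up {A'} {B'} {0ᴹ} {D'}
    ↓↓' = block-down-down {A'} {B'} {0ᴹ} {D'}

  ⌈⌉-cong : ∀ {A A' B B' D D' : Mat p 2} → A ≃ A' → B ≃ B' → D ≃ D' → ⌈ A , B , D ⌉ ≃ ⌈ A' , B' , D' ⌉
  ⌈⌉-cong {A} {A'} {B} {B'} {D} {D'} eA eB eD =
    blocks-cong {A} {A'} {B} {B'} {0ᴹ} {0ᴹ} {D} {D'} eA eB ≃-refl eD

  idM-⌈⌉ : idM ≃ ⌈ idM , 0ᴹ , idM ⌉
  idM-⌈⌉ = exactly λ m r c → cong (λ x → seq x m) (entry r c)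
    where
    entry : ∀ r c → idM r c ≡ ⌈ idM , 0ᴹ , idM ⌉ r c
    entry zero zero = refl
    entry zero (suc zero) = refl
    entry zero (suc (suc zero)) = refl
    entry zero (suc (suc (suc zero))) = refl
    entry (suc zero) zero = refl
    entry (suc zero) (suc zero) = refl
    entry (suc zero) (suc (suc zero)) = refl
    entry (suc zero) (suc (suc (suc zero))) = refl
    entry (suc (suc zero)) zero = refl
    entry (suc (suc zero)) (suc zero) = refl
    entry (suc (suc zero)) (suc (suc zero)) = refl
    entry (suc (suc zero)) (suc (suc (suc zero))) = refl
    entry (suc (suc (suc zero))) zero = refl
    entry (suc (suc (suc zero))) (suc zero) = refl
    entry (suc (suc (suc zero))) (suc (suc zero)) = refl
    entry (suc (suc (suc zero))) (suc (suc (suc zero))) = refl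

  IsGL-⌈⌉ : ∀ {A D : Mat p 2} B → IsGL A → IsGL D → IsGL ⌈ A , B , D ⌉
  IsGL-⌈⌉ {A} {D} B glA@(A⁻¹ , _) glD@(D⁻¹ , _) =
    IsGL-intro {X = ⌈ A , B , D ⌉} ⌈ A⁻¹ , ⊖ (A⁻¹ ⊗ B ⊗ D⁻¹) , D⁻¹ ⌉ right left
    where
    AA⁻¹ = IsGL-inverseʳ {X = A} glA
    A⁻¹A = IsGL-inverseˡ {X = A} glA
    DD⁻¹ = IsGL-inverseʳ {X = D} glD
    D⁻¹D = IsGL-inverseˡ {X = D} glD

    right-corner : A ⊗ ⊖ (A⁻¹ ⊗ B ⊗ D⁻¹) ⊕ B ⊗ D⁻¹ ≃ 0ᴹ
    right-corner = begin
      A ⊗ ⊖ (A⁻¹ ⊗ B ⊗ D⁻¹) ⊕ B ⊗ D⁻¹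
        ≈⟨ ⊕-congʳ (B ⊗ D⁻¹) {A ⊗ ⊖ (A⁻¹ ⊗ B ⊗ D⁻¹)} {⊖ (A ⊗ (A⁻¹ ⊗ B ⊗ D⁻¹))}
             (⊗-⊖ʳ A (A⁻¹ ⊗ B ⊗ D⁻¹)) ⟩
      ⊖ (A ⊗ (A⁻¹ ⊗ B ⊗ D⁻¹)) ⊕ B ⊗ D⁻¹
        ≈⟨ ⊕-congʳ (B ⊗ D⁻¹) {⊖ (A ⊗ (A⁻¹ ⊗ B ⊗ D⁻¹))} {⊖ (B ⊗ D⁻¹)}
             (⊖-cong {X = A ⊗ (A⁻¹ ⊗ B ⊗ D⁻¹)} {B ⊗ D⁻¹} A[A⁻¹BD⁻¹]) ⟩
      ⊖ (B ⊗ D⁻¹) ⊕ B ⊗ D⁻¹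
        ≈⟨ ⊖-inverseˡ (B ⊗ D⁻¹) ⟩
      0ᴹ ∎
      where
      open import Relation.Binary.Reasoning.Setoid ≃-setoid
      A[A⁻¹BD⁻¹] : A ⊗ (A⁻¹ ⊗ B ⊗ D⁻¹) ≃ B ⊗ D⁻¹
      A[A⁻¹BD⁻¹] = ≃-trans (≃-sym (⊗-assoc A (A⁻¹ ⊗ B) D⁻¹))
                           (⊗-congʳ D⁻¹ {A ⊗ (A⁻¹ ⊗ B)} {B} (⊗-cancelˡ {X = A⁻¹} {A} B AA⁻¹))

    left-corner : A⁻¹ ⊗ B ⊕ ⊖ (A⁻¹ ⊗ B ⊗ D⁻¹) ⊗ D ≃ 0ᴹ
    left-corner = begin
      A⁻¹ ⊗ B ⊕ ⊖ (A⁻¹ ⊗ B ⊗ D⁻¹) ⊗ D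
        ≈⟨ ⊕-congˡ (A⁻¹ ⊗ B) {⊖ (A⁻¹ ⊗ B ⊗ D⁻¹) ⊗ D} {⊖ (A⁻¹ ⊗ B ⊗ D⁻¹ ⊗ D)}
             (⊖-⊗ˡ (A⁻¹ ⊗ B ⊗ D⁻¹) D) ⟩
      A⁻¹ ⊗ B ⊕ ⊖ (A⁻¹ ⊗ B ⊗ D⁻¹ ⊗ D)
        ≈⟨ ⊕-congˡ (A⁻¹ ⊗ B) {⊖ (A⁻¹ ⊗ B ⊗ D⁻¹ ⊗ D)} {⊖ (A⁻¹ ⊗ B)}
             (⊖-cong {X = A⁻¹ ⊗ B ⊗ D⁻¹ ⊗ D} {A⁻¹ ⊗ B} (⊗-cancelʳ {X = D⁻¹} {D} (A⁻¹ ⊗ B) D⁻¹D)) ⟩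
      A⁻¹ ⊗ B ⊕ ⊖ (A⁻¹ ⊗ B)
        ≈⟨ ⊖-inverseʳ (A⁻¹ ⊗ B) ⟩
      0ᴹ ∎
      where open import Relation.Binary.Reasoning.Setoid ≃-setoid

    right : ⌈ A , B , D ⌉ ⊗ ⌈ A⁻¹ , ⊖ (A⁻¹ ⊗ B ⊗ D⁻¹) , D⁻¹ ⌉ ≃ idM
    right = ≃-trans (⌈⌉-⊗ A B D A⁻¹ (⊖ (A⁻¹ ⊗ B ⊗ D⁻¹)) D⁻¹) (≃-trans
      (⌈⌉-cong {A ⊗ A⁻¹} {idM} {A ⊗ ⊖ (A⁻¹ ⊗ B ⊗ D⁻¹) ⊕ B ⊗ D⁻¹} {0ᴹ} {D ⊗ D⁻¹} {idM}
        AA⁻¹ right-corner DD⁻¹)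
      (≃-sym idM-⌈⌉))

    left : ⌈ A⁻¹ , ⊖ (A⁻¹ ⊗ B ⊗ D⁻¹) , D⁻¹ ⌉ ⊗ ⌈ A , B , D ⌉ ≃ idM
    left = ≃-trans (⌈⌉-⊗ A⁻¹ (⊖ (A⁻¹ ⊗ B ⊗ D⁻¹)) D⁻¹ A B D) (≃-trans
      (⌈⌉-cong {A⁻¹ ⊗ A} {idM} {A⁻¹ ⊗ B ⊕ ⊖ (A⁻¹ ⊗ B ⊗ D⁻¹) ⊗ D} {0ᴹ} {D⁻¹ ⊗ D} {idM}
        A⁻¹A left-corner D⁻¹D)
      (≃-sym idM-⌈⌉))

  block-cong : ∀ r c {G H : Mat p 4} → G ≃ H → block r c G ≃ block r c H
  block-cong r c e = levelwise λ m a b → at e m (r a) (c b)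

  κA-block : ∀ G → κA G ≃ block up up G
  κA-block G = exactly λ m a b → cong (λ x → seq x m) (entry a b)
    where
    entry : ∀ a b → κA G a b ≡ block up up G a b
    entry zero       zero       = refl
    entry zero       (suc zero) = refl
    entry (suc zero) zero       = refl
    entry (suc zero) (suc zero) = refl

  κD-block : ∀ G → κD G ≃ block down down G
  κD-block G = exactly λ m a b → cong (λ x → seq x m) (entry a b)
    where
    entry : ∀ a b → κD G a b ≡ block down down G a b
    entry zero       zero       = refl
    entry zero       (suc zero) = refl
    entry (suc zero) zero       = refl
    entry (suc zero) (suc zero) = refl

  InP⇒lower-left≃0 : ∀ {g : Mat p 4} → InP g → block down up g ≃ 0ᴹ
  InP⇒lower-left≃0 (g20 , g21 , g30 , g31) = levelwise λ m → λ where
    zero       zero       → wrap (g20 m)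
    zero       (suc zero) → wrap (g21 m)
    (suc zero) zero       → wrap (g30 m)
    (suc zero) (suc zero) → wrap (g31 m)

  IsGL-diagonal : ∀ {g : Mat p 4} → InP g → IsGL g → IsGL (κA g) × IsGL (κD g)
  IsGL-diagonal {g} g∈P glg@(h , _) =
    IsGL-fromˡ {X = κA g} {κA h} (begin
      κA h ⊗ κA g
        ≈⟨ ⊕-identityʳ (κA h ⊗ κA g) ⟨
      κA h ⊗ κA g ⊕ 0ᴹ
        ≈⟨ ⊕-congˡ (κA h ⊗ κA g) {0ᴹ} {block up down h ⊗ 0ᴹ} (≃-sym (⊗-zeroʳ (block up down h))) ⟩
      κA h ⊗ κA g ⊕ block up down h ⊗ 0ᴹ
        ≈⟨ block-⊗-≃ up up h g {κA h} {κA g} {block up down h} {0ᴹ}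
             (≃-sym (κA-block h)) (≃-sym (κA-block g)) ≃-refl (InP⇒lower-left≃0 {g = g} g∈P) ⟨
      block up up (h ⊗ g)
        ≈⟨ block-cong up up {h ⊗ g} {idM} (IsGL-inverseˡ {X = g} glg) ⟩
      block up up idM
        ≈⟨ block-cong up up {idM} {⌈ idM , 0ᴹ , idM ⌉} idM-⌈⌉ ⟩
      block up up ⌈ idM , 0ᴹ , idM ⌉
        ≈⟨ block-up-up {idM} {0ᴹ} {0ᴹ} {idM} ⟩
      idM ∎) ,
    IsGL-fromʳ {X = κD g} {κD h} (begin
      κD g ⊗ κD h
        ≈⟨ ⊕-identityˡ (κD g ⊗ κD h) ⟨
      0ᴹ ⊕ κD g ⊗ κD h
        ≈⟨ ⊕-congʳ (κD g ⊗ κD h) {0ᴹ} {0ᴹ ⊗ block up down h} (≃-sym (⊗-zeroˡ (block up down h))) ⟩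
      0ᴹ ⊗ block up down h ⊕ κD g ⊗ κD h
        ≈⟨ block-⊗-≃ down down g h {0ᴹ} {block up down h} {κD g} {κD h}
             (InP⇒lower-left≃0 {g = g} g∈P) ≃-refl (≃-sym (κD-block g)) (≃-sym (κD-block h)) ⟨
      block down down (g ⊗ h)
        ≈⟨ block-cong down down {g ⊗ h} {idM} (IsGL-inverseʳ {X = g} glg) ⟩
      block down down idM
        ≈⟨ block-cong down down {idM} {⌈ idM , 0ᴹ , idM ⌉} idM-⌈⌉ ⟩
      block down down ⌈ idM , 0ᴹ , idM ⌉
        ≈⟨ block-down-down {idM} {0ᴹ} {0ᴹ} {idM} ⟩
      idM ∎)
    where open import Relation.Binary.Reasoning.Setoid ≃-setoid

module _ {p n : ℕ} where

  ⊗-row-idM : ∀ (Y X : Mat p n) r → (∀ k → Y r k ≡ idM r k) → ∀ m c → level m (Y ⊗ X) r c ≡ level m X r c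
  ⊗-row-idM Y X r Yr≡ m c = begin
    level m (Y ⊗ X) r c            ≡⟨ level-⊗ m Y X r c ⟩
    (level m Y · level m X) r c    ≡⟨ sum-cong-≗ (λ k → cong (λ y → seq y m * level m X k c) (Yr≡ k)) ⟩
    (level m idM · level m X) r c  ≡⟨ sum-cong-≗ (λ k → cong (_* level m X k c) (level-idM m r k)) ⟩
    (δ · level m X) r c            ≡⟨ ·-identityˡ (level m X) r c ⟩
    level m X r c                  ∎
    where open ≡-Reasoning

  ⊗-col-idM : ∀ (X Y : Mat p n) c → (∀ k → Y k c ≡ idM k c) → ∀ m r → level m (X ⊗ Y) r c ≡ level m X r c
  ⊗-col-idM X Y c Yc≡ m r = begin
    level m (X ⊗ Y) r c            ≡⟨ level-⊗ m X Y r c ⟩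
    (level m X · level m Y) r c    ≡⟨ sum-cong-≗ (λ k → cong (λ y → level m X r k * seq y m) (Yc≡ k)) ⟩
    (level m X · level m idM) r c  ≡⟨ sum-cong-≗ (λ k → cong (level m X r k *_) (level-idM m k c)) ⟩
    (level m X · δ) r c            ≡⟨ ·-identityʳ (level m X) r c ⟩
    level m X r c                  ∎
    where open ≡-Reasoning

module Conjugation {p : ℕ} (i : ℕ) where

  P : ℤ
  P = + (p ℕ.^ i)

  -- ξ and ξ⁻¹ differ from idM only in the entry (3, 1), so only row 3 of ξ ⊗ X and column 1 of
  -- X ⊗ ξ differ from those of X.
  ξ-row3 : ∀ (X : Mat p 4) m c → level m (ξ p i ⊗ X) i3 c ≡ level m X i3 c + P * level m X i1 c
  ξ-row3 X m c = expand P (level m X i0 c) (level m X i1 c) (level m X i2 c) (level m X i3 c)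
    where
    expand : ∀ P a b c d → 0ℤ * a + (P * b + (0ℤ * c + (1ℤ * d + 0ℤ))) ≡ d + P * b
    expand = solve-∀

  ξ⁻¹-row3 : ∀ (X : Mat p 4) m c → level m (ξ⁻¹ p i ⊗ X) i3 c ≡ level m X i3 c - P * level m X i1 c
  ξ⁻¹-row3 X m c = expand P (level m X i0 c) (level m X i1 c) (level m X i2 c) (level m X i3 c)
    where
    expand : ∀ P a b c d → 0ℤ * a + (- P * b + (0ℤ * c + (1ℤ * d + 0ℤ))) ≡ d - P * b
    expand = solve-∀

  ⊗ξ-col1 : ∀ (X : Mat p 4) m r → level m (X ⊗ ξ p i) r i1 ≡ level m X r i1 + P * level m X r i3
  ⊗ξ-col1 X m r = expand P (level m X r i0) (level m X r i1) (level m X r i2) (level m X r i3)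
    where
    expand : ∀ P a b c d → a * 0ℤ + (b * 1ℤ + (c * 0ℤ + (d * P + 0ℤ))) ≡ b + P * d
    expand = solve-∀

  private
    x+P*0≡x : ∀ x → x + P * 0ℤ ≡ x
    x+P*0≡x x = trans (cong (λ y → x + y) (ℤ.*-zeroʳ P)) (ℤ.+-identityʳ x)

    x-P*0≡x : ∀ x → x - P * 0ℤ ≡ x
    x-P*0≡x x = trans (cong (λ y → x - y) (ℤ.*-zeroʳ P)) (ℤ.+-identityʳ x)

    P*1≡P : P * 1ℤ ≡ P
    P*1≡P = ℤ.*-identityʳ P

  ξ-inverseʳ : ξ p i ⊗ ξ⁻¹ p i ≃ idM
  ξ-inverseʳ = exactly entry
    where
    entry : ∀ m r c → level m (ξ p i ⊗ ξ⁻¹ p i) r c ≡ level m idM r c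
    entry m zero                   c = ⊗-row-idM (ξ p i) (ξ⁻¹ p i) i0 (λ k → refl) m c
    entry m (suc zero)             c = ⊗-row-idM (ξ p i) (ξ⁻¹ p i) i1 (λ k → refl) m c
    entry m (suc (suc zero))       c = ⊗-row-idM (ξ p i) (ξ⁻¹ p i) i2 (λ k → refl) m c
    entry m (suc (suc (suc zero))) zero                   = trans (ξ-row3 (ξ⁻¹ p i) m i0) (x+P*0≡x 0ℤ)
    entry m (suc (suc (suc zero))) (suc zero)             =
      trans (ξ-row3 (ξ⁻¹ p i) m i1) (trans (cong (λ y → - P + y) P*1≡P) (ℤ.+-inverseˡ P))
    entry m (suc (suc (suc zero))) (suc (suc zero))       = trans (ξ-row3 (ξ⁻¹ p i) m i2) (x+P*0≡x 0ℤ)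
    entry m (suc (suc (suc zero))) (suc (suc (suc zero))) = trans (ξ-row3 (ξ⁻¹ p i) m i3) (x+P*0≡x 1ℤ)

  ξ-inverseˡ : ξ⁻¹ p i ⊗ ξ p i ≃ idM
  ξ-inverseˡ = exactly entry
    where
    entry : ∀ m r c → level m (ξ⁻¹ p i ⊗ ξ p i) r c ≡ level m idM r c
    entry m zero                   c = ⊗-row-idM (ξ⁻¹ p i) (ξ p i) i0 (λ k → refl) m c
    entry m (suc zero)             c = ⊗-row-idM (ξ⁻¹ p i) (ξ p i) i1 (λ k → refl) m c
    entry m (suc (suc zero))       c = ⊗-row-idM (ξ⁻¹ p i) (ξ p i) i2 (λ k → refl) m c
    entry m (suc (suc (suc zero))) zero                   = trans (ξ⁻¹-row3 (ξ p i) m i0) (x-P*0≡x 0ℤ)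
    entry m (suc (suc (suc zero))) (suc zero)             =
      trans (ξ⁻¹-row3 (ξ p i) m i1) (trans (cong (λ y → P - y) P*1≡P) (ℤ.+-inverseʳ P))
    entry m (suc (suc (suc zero))) (suc (suc zero))       = trans (ξ⁻¹-row3 (ξ p i) m i2) (x-P*0≡x 0ℤ)
    entry m (suc (suc (suc zero))) (suc (suc (suc zero))) = trans (ξ⁻¹-row3 (ξ p i) m i3) (x-P*0≡x 1ℤ)

  conj-row3 : ∀ g m c → (∀ k → ξ p i k c ≡ idM k c) →
              level m (ξ⁻¹ p i ⊗ g ⊗ ξ p i) i3 c ≡ level m g i3 c - P * level m g i1 c
  conj-row3 g m c ξ≡idM = trans (⊗-col-idM (ξ⁻¹ p i ⊗ g) (ξ p i) c ξ≡idM m i3) (ξ⁻¹-row3 g m c)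

  conj-30 : ∀ g m → level m (ξ⁻¹ p i ⊗ g ⊗ ξ p i) i3 i0 ≡ level m g i3 i0 - P * level m g i1 i0
  conj-30 g m = conj-row3 g m i0 λ { zero → refl ; (suc zero) → refl ; (suc (suc zero)) → refl ; (suc (suc (suc zero))) → refl }

  conj-31 : ∀ g m → level m (ξ⁻¹ p i ⊗ g ⊗ ξ p i) i3 i1
                  ≡ (level m g i3 i1 - P * level m g i1 i1) + P * (level m g i3 i3 - P * level m g i1 i3)
  conj-31 g m = trans (⊗ξ-col1 (ξ⁻¹ p i ⊗ g) m i3) (cong₂ (λ a b → a + P * b) (ξ⁻¹-row3 g m i1) (ξ⁻¹-row3 g m i3))

  conj-32 : ∀ g m → level m (ξ⁻¹ p i ⊗ g ⊗ ξ p i) i3 i2 ≡ level m g i3 i2 - P * level m g i1 i2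
  conj-32 g m = conj-row3 g m i2 λ { zero → refl ; (suc zero) → refl ; (suc (suc zero)) → refl ; (suc (suc (suc zero))) → refl }

  conj-33 : ∀ g m → level m (ξ⁻¹ p i ⊗ g ⊗ ξ p i) i3 i3 ≡ level m g i3 i3 - P * level m g i1 i3
  conj-33 g m = conj-row3 g m i3 λ { zero → refl ; (suc zero) → refl ; (suc (suc zero)) → refl ; (suc (suc (suc zero))) → refl }

  ξ-IsGL : IsGL (ξ p i)
  ξ-IsGL = IsGL-intro {X = ξ p i} (ξ⁻¹ p i) ξ-inverseʳ ξ-inverseˡ

  ξ⁻¹-IsGL : IsGL (ξ⁻¹ p i)
  ξ⁻¹-IsGL = IsGL-intro {X = ξ⁻¹ p i} (ξ p i) ξ-inverseˡ ξ-inverseʳ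

  Mira-resp : ∀ {m} {X Y : Mat p 4} → X ≃ Y → Mira p m X → Mira p m Y
  Mira-resp {m} {X} {Y} X≃Y (glX , x30 , x31 , x32 , x33) =
    IsGL-resp {X = X} {Y} X≃Y glX , move i0 0ₚ x30 , move i1 0ₚ x31 , move i2 0ₚ x32 , move i3 1ₚ x33
    where
    move : ∀ j (z : ℤₚ p) → X i3 j ≡ₚ z [mod^ m ] → Y i3 j ≡ₚ z [mod^ m ]
    move j z e = unwrap (≅-trans {a = level m Y i3 j} {level m X i3 j} {seq z m} (≅-sym (at X≃Y m i3 j)) (wrap e))

  InConj⇒Mira : ∀ {m g} → InConj p i m g → Mira p m (ξ⁻¹ p i ⊗ g ⊗ ξ p i)
  InConj⇒Mira {m} {g} (k , k∈K , g≈ξkξ⁻¹) = Mira-resp {X = k} {ξ⁻¹ p i ⊗ g ⊗ ξ p i} (≃-sym (≃-trans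
    (⊗-congʳ (ξ p i) {ξ⁻¹ p i ⊗ g} {ξ⁻¹ p i ⊗ (ξ p i ⊗ k ⊗ ξ⁻¹ p i)}
      (⊗-congˡ (ξ⁻¹ p i) {g} {ξ p i ⊗ k ⊗ ξ⁻¹ p i} (≈ᴹ⇒≃ {X = g} {ξ p i ⊗ k ⊗ ξ⁻¹ p i} g≈ξkξ⁻¹)))
    (⊗-conjugate-cancel {X = ξ p i} {ξ⁻¹ p i} k ξ-inverseˡ))) k∈K

  Mira⇒InConj : ∀ {m g} → Mira p m (ξ⁻¹ p i ⊗ g ⊗ ξ p i) → InConj p i m g
  Mira⇒InConj {m} {g} conj∈K = ξ⁻¹ p i ⊗ g ⊗ ξ p i , conj∈K ,
    ≃⇒≈ᴹ {X = g} {ξ p i ⊗ (ξ⁻¹ p i ⊗ g ⊗ ξ p i) ⊗ ξ⁻¹ p i}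
      (≃-sym (⊗-conjugate-cancel {X = ξ⁻¹ p i} {ξ p i} g ξ-inverseʳ))

module _ {k q : ℕ} where
  open import Relation.Binary.Reasoning.Setoid (≅-setoid {k ℕ.* q})

  multiple≅0⇒≅0 : ∀ .{{_ : NonZero k}} {a x} → a ≅ 0ℤ [mod k ℕ.* q ] →
                  a - + k * x ≅ 0ℤ [mod k ℕ.* q ] → x ≅ 0ℤ [mod q ]
  multiple≅0⇒≅0 {a} {x} a≅0 a-kx≅0 = *-cancelˡ-≅ k (begin
    + k * x              ≡⟨ identity a (+ k * x) ⟩
    a - (a - + k * x)    ≈⟨ +-cong-≅ a≅0 (neg-cong-≅ a-kx≅0) ⟩
    0ℤ - 0ℤ              ≡⟨ ℤ.*-zeroʳ (+ k) ⟨
    + k * 0ℤ             ∎)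
    where
    identity : ∀ a y → y ≡ a - (a - y)
    identity = solve-∀

  multiple≅1⇒≅1 : ∀ .{{_ : NonZero k}} {a s y} → a ≅ 0ℤ [mod k ℕ.* q ] → s ≅ 1ℤ [mod k ℕ.* q ] →
                  (a - + k * y) + + k * s ≅ 0ℤ [mod k ℕ.* q ] → y ≅ 1ℤ [mod q ]
  multiple≅1⇒≅1 {a} {s} {y} a≅0 s≅1 h = *-cancelˡ-≅ k (begin
    + k * y                                  ≡⟨ identity a s (+ k) y ⟩
    (a + + k * s) - ((a - + k * y) + + k * s)
      ≈⟨ +-cong-≅ (+-cong-≅ a≅0 (*-cong-≅ (≅-refl {a = + k}) s≅1)) (neg-cong-≅ h) ⟩
    (0ℤ + + k * 1ℤ) - 0ℤ                     ≡⟨ identity′ (+ k * 1ℤ) ⟩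
    + k * 1ℤ                                 ∎)
    where
    identity : ∀ a s k y → k * y ≡ (a + k * s) - ((a - k * y) + k * s)
    identity = solve-∀
    identity′ : ∀ x → (0ℤ + x) - 0ℤ ≡ x
    identity′ = solve-∀

  ≅0⇒scaled≅0 : ∀ {x} → x ≅ 0ℤ [mod q ] → 0ℤ - + k * x ≅ 0ℤ [mod k ℕ.* q ]
  ≅0⇒scaled≅0 {x} x≅0 = begin
    0ℤ - + k * x   ≈⟨ +-cong-≅ (≅-refl {a = 0ℤ}) (neg-cong-≅ (*-scaleˡ-≅ k x≅0)) ⟩
    0ℤ - + k * 0ℤ  ≡⟨ cong (λ z → 0ℤ - z) (ℤ.*-zeroʳ (+ k)) ⟩
    0ℤ             ∎

  ≅1⇒scaled≅0 : ∀ {y s} → y ≅ 1ℤ [mod q ] → s ≡ 1ℤ → (0ℤ - + k * y) + + k * s ≅ 0ℤ [mod k ℕ.* q ]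
  ≅1⇒scaled≅0 {y} {s} y≅1 refl = begin
    (0ℤ - + k * y) + + k * 1ℤ
      ≈⟨ +-cong-≅ (+-cong-≅ (≅-refl {a = 0ℤ}) (neg-cong-≅ (*-scaleˡ-≅ k y≅1))) (≅-refl {a = + k * 1ℤ}) ⟩
    (0ℤ - + k * 1ℤ) + + k * 1ℤ  ≡⟨ cancel (+ k * 1ℤ) ⟩
    0ℤ                          ∎
    where
    cancel : ∀ x → (0ℤ - x) + x ≡ 0ℤ
    cancel = solve-∀

≅-drop-multiple : ∀ {k q z w c} → z - + k * w ≅ c [mod k ℕ.* q ] → z ≅ c [mod k ]
≅-drop-multiple {k} {q} {z} {w} {c} h = begin
  z                       ≡⟨ identity z (+ k * w) ⟩
  (z - + k * w) + + k * w ≈⟨ +-cong-≅ (≅-∣ (m∣m*n q) h) (multiple-≅-0 k w) ⟩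
  c + 0ℤ                  ≡⟨ ℤ.+-identityʳ c ⟩
  c                       ∎
  where
  open import Relation.Binary.Reasoning.Setoid (≅-setoid {k})
  identity : ∀ z x → z ≡ (z - x) + x
  identity = solve-∀

sub-multiple : ∀ z c w k → z - c ≡ w * k → z - k * w ≡ c
sub-multiple z c w k e = begin
  z - k * w            ≡⟨ regroup z c w k ⟩
  (z - c) - k * w + c  ≡⟨ cong (λ t → t - k * w + c) e ⟩
  w * k - k * w + c    ≡⟨ cancel w k c ⟩
  c                    ∎
  where
  open ≡-Reasoning
  regroup : ∀ z c w k → z - k * w ≡ (z - c) - k * w + c
  regroup = solve-∀
  cancel : ∀ w k c → w * k - k * w + c ≡ c
  cancel = solve-∀

module _ {p : ℕ} where

  K₂-intro : ∀ {j N} {X : Mat p 2} → j ℕ.≤ N → IsGL X →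
             seq (X i1₂ i0₂) N ≅ 0ℤ [mod p ℕ.^ j ] → seq (X i1₂ i1₂) N ≅ 1ℤ [mod p ℕ.^ j ] → K₂ p j X
  K₂-intro {X = X} j≤N glX x₁₀ x₁₁ = glX ,
    unwrap (≅-trans (≅-sym (seq-stable (X i1₂ i0₂) j≤N)) x₁₀) ,
    unwrap (≅-trans (≅-sym (seq-stable (X i1₂ i1₂) j≤N)) x₁₁)

  K₂-elim : ∀ {j N} {X : Mat p 2} → j ℕ.≤ N → K₂ p j X →
            (seq (X i1₂ i0₂) N ≅ 0ℤ [mod p ℕ.^ j ]) × (seq (X i1₂ i1₂) N ≅ 1ℤ [mod p ℕ.^ j ])
  K₂-elim {X = X} j≤N (_ , x₁₀ , x₁₁) =
    ≅-trans (seq-stable (X i1₂ i0₂) j≤N) (wrap x₁₀) , ≅-trans (seq-stable (X i1₂ i1₂) j≤N) (wrap x₁₁)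

module Directions {p : ℕ} .{{_ : NonZero p}} (i r : ℕ) where
  open Conjugation {p} i

  private
    N : ℕ
    N = i ℕ.+ r

    instance
      p^i≢0 : NonZero (p ℕ.^ i)
      p^i≢0 = ℕ.m^n≢0 p i

    split : ∀ {a b} → a ≅ b [mod p ℕ.^ N ] → a ≅ b [mod p ℕ.^ i ℕ.* p ℕ.^ r ]
    split {a} {b} = subst (λ M → a ≅ b [mod M ]) (ℕ.^-distribˡ-+-* p i r)

    merge : ∀ {a b} → a ≅ b [mod p ℕ.^ i ℕ.* p ℕ.^ r ] → a ≅ b [mod p ℕ.^ N ]
    merge {a} {b} = subst (λ M → a ≅ b [mod M ]) (sym (ℕ.^-distribˡ-+-* p i r))

    at-level : ∀ m (x y : ℤₚ p) → x ≡ₚ y [mod^ m ] → seq x m ≅ seq y m [mod p ℕ.^ m ]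
    at-level m x y = wrap

  InConj⇒IsGL : ∀ {m g} → InConj p i m g → IsGL g
  InConj⇒IsGL {g = g} (k , (glk , _) , g≈ξkξ⁻¹) =
    IsGL-resp {X = ξ p i ⊗ k ⊗ ξ⁻¹ p i} {g} (≃-sym (≈ᴹ⇒≃ {X = g} {ξ p i ⊗ k ⊗ ξ⁻¹ p i} g≈ξkξ⁻¹))
      (IsGL-⊗ {X = ξ p i ⊗ k} {ξ⁻¹ p i} (IsGL-⊗ {X = ξ p i} {k} ξ-IsGL glk) ξ⁻¹-IsGL)

  Mira-conj⇒congruences : ∀ {g} → InP g → Mira p N (ξ⁻¹ p i ⊗ g ⊗ ξ p i) →
    (level N g i1 i0 ≅ 0ℤ [mod p ℕ.^ r ]) × (level N g i1 i1 ≅ 1ℤ [mod p ℕ.^ r ]) ×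
    (level N g i3 i2 ≅ 0ℤ [mod p ℕ.^ i ]) × (level N g i3 i3 ≅ 1ℤ [mod p ℕ.^ i ])
  Mira-conj⇒congruences {g} (_ , _ , g₃₀ , g₃₁) (_ , k₃₀ , k₃₁ , k₃₂ , k₃₃) =
    multiple≅0⇒≅0 {p ℕ.^ i} {p ℕ.^ r} (split (at-level N (g i3 i0) 0ₚ (g₃₀ N))) (split c₃₀) ,
    multiple≅1⇒≅1 {p ℕ.^ i} {p ℕ.^ r} (split (at-level N (g i3 i1) 0ₚ (g₃₁ N))) (split c₃₃) (split c₃₁) ,
    ≅-drop-multiple {p ℕ.^ i} {p ℕ.^ r} (split c₃₂) ,
    ≅-drop-multiple {p ℕ.^ i} {p ℕ.^ r} (split c₃₃)
    where
    conj = ξ⁻¹ p i ⊗ g ⊗ ξ p i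
    c₃₀ : level N g i3 i0 - P * level N g i1 i0 ≅ 0ℤ [mod p ℕ.^ N ]
    c₃₀ = ≅-trans (≅-reflexive (sym (conj-30 g N))) (at-level N (conj i3 i0) 0ₚ k₃₀)
    c₃₁ : (level N g i3 i1 - P * level N g i1 i1) + P * (level N g i3 i3 - P * level N g i1 i3) ≅ 0ℤ [mod p ℕ.^ N ]
    c₃₁ = ≅-trans (≅-reflexive (sym (conj-31 g N))) (at-level N (conj i3 i1) 0ₚ k₃₁)
    c₃₂ : level N g i3 i2 - P * level N g i1 i2 ≅ 0ℤ [mod p ℕ.^ N ]
    c₃₂ = ≅-trans (≅-reflexive (sym (conj-32 g N))) (at-level N (conj i3 i2) 0ₚ k₃₂)
    c₃₃ : level N g i3 i3 - P * level N g i1 i3 ≅ 1ℤ [mod p ℕ.^ N ]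
    c₃₃ = ≅-trans (≅-reflexive (sym (conj-33 g N))) (at-level N (conj i3 i3) 1ₚ k₃₃)

  private
    r≤N : r ℕ.≤ N
    r≤N = ℕ.m≤n+m r i

    i≤N : i ℕ.≤ N
    i≤N = ℕ.m≤m+n i r

    transfer : ∀ {j c} (x y : ℤₚ p) → j ℕ.≤ N → x ≈ₚ y →
               seq x N ≅ c [mod p ℕ.^ j ] → seq y N ≅ c [mod p ℕ.^ j ]
    transfer x y j≤N x≈y = ≅-trans (≅-sym (≅-∣ (^-monoʳ-∣ p j≤N) (at-level N x y (x≈y N))))

  image⇒K×K : ∀ {A D} → InImage p i N A D → InKK p r i A D
  image⇒K×K {A} {D} (g , g∈P , g∈ξKξ⁻¹ , κAg≈A , κDg≈D) =
    assemble (Mira-conj⇒congruences {g} g∈P (InConj⇒Mira {N} {g} g∈ξKξ⁻¹))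
             (IsGL-diagonal {g = g} g∈P (InConj⇒IsGL {N} {g} g∈ξKξ⁻¹))
    where
    assemble : (level N g i1 i0 ≅ 0ℤ [mod p ℕ.^ r ]) × (level N g i1 i1 ≅ 1ℤ [mod p ℕ.^ r ]) ×
               (level N g i3 i2 ≅ 0ℤ [mod p ℕ.^ i ]) × (level N g i3 i3 ≅ 1ℤ [mod p ℕ.^ i ]) →
               IsGL (κA g) × IsGL (κD g) → InKK p r i A D
    assemble (g₁₀ , g₁₁ , g₃₂ , g₃₃) (glκA , glκD) =
      K₂-intro {j = r} {N} {A} r≤N (IsGL-resp {X = κA g} {A} (≈ᴹ⇒≃ {X = κA g} {A} κAg≈A) glκA)
        (transfer (g i1 i0) (A i1₂ i0₂) r≤N (κAg≈A i1₂ i0₂) g₁₀)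
        (transfer (g i1 i1) (A i1₂ i1₂) r≤N (κAg≈A i1₂ i1₂) g₁₁) ,
      K₂-intro {j = i} {N} {D} i≤N (IsGL-resp {X = κD g} {D} (≈ᴹ⇒≃ {X = κD g} {D} κDg≈D) glκD)
        (transfer (g i3 i2) (D i1₂ i0₂) i≤N (κDg≈D i1₂ i0₂) g₃₂)
        (transfer (g i3 i3) (D i1₂ i1₂) i≤N (κDg≈D i1₂ i1₂) g₃₃)

  K×K⇒image : ∀ {A D} → InKK p r i A D → InImage p i N A D
  K×K⇒image {A} {D} (A∈K@(glA , _) , D∈K@(glD , _)) =
    assemble (K₂-elim {j = r} {N} {A} r≤N A∈K) (K₂-elim {j = i} {N} {D} i≤N D∈K)
    where
    assemble : (seq (A i1₂ i0₂) N ≅ 0ℤ [mod p ℕ.^ r ]) × (seq (A i1₂ i1₂) N ≅ 1ℤ [mod p ℕ.^ r ]) →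
               (seq (D i1₂ i0₂) N ≅ 0ℤ [mod p ℕ.^ i ]) × (seq (D i1₂ i1₂) N ≅ 1ℤ [mod p ℕ.^ i ]) →
               InImage p i N A D
    assemble (a₁₀ , a₁₁) (wrap (c , d₁₀≡cP) , wrap (u , d₁₁-1≡uP)) =
      ⌈ A , B , D ⌉ , ((λ _ → 0ℤ , refl) , (λ _ → 0ℤ , refl) , (λ _ → 0ℤ , refl) , (λ _ → 0ℤ , refl)) ,
      Mira⇒InConj {N} {⌈ A , B , D ⌉} (gl , k₃₀ , k₃₁ , k₃₂ , k₃₃) ,
      ≃⇒≈ᴹ {X = κA ⌈ A , B , D ⌉} {A} (≃-trans (κA-block ⌈ A , B , D ⌉) (block-up-up {A = A} {B} {0ᴹ} {D})) ,
      ≃⇒≈ᴹ {X = κD ⌈ A , B , D ⌉} {D} (≃-trans (κD-block ⌈ A , B , D ⌉) (block-down-down {A = A} {B} {0ᴹ} {D}))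
      where
      -- The upper right block is chosen so that the last row of the conjugate is exactly (∗, ∗, 0, 1).
      B : Mat p 2
      B zero       _          = 0ₚ
      B (suc zero) zero       = fromℤ c
      B (suc zero) (suc zero) = fromℤ u

      gl : IsGL (ξ⁻¹ p i ⊗ ⌈ A , B , D ⌉ ⊗ ξ p i)
      gl = IsGL-⊗ {X = ξ⁻¹ p i ⊗ ⌈ A , B , D ⌉} {ξ p i}
             (IsGL-⊗ {X = ξ⁻¹ p i} {⌈ A , B , D ⌉} ξ⁻¹-IsGL (IsGL-⌈⌉ {A = A} {D} B glA glD)) ξ-IsGL

      k₃₀ : (ξ⁻¹ p i ⊗ ⌈ A , B , D ⌉ ⊗ ξ p i) i3 i0 ≡ₚ 0ₚ [mod^ N ]
      k₃₀ = unwrap (≅-trans (≅-reflexive (conj-30 ⌈ A , B , D ⌉ N))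
              (merge (≅0⇒scaled≅0 {p ℕ.^ i} {p ℕ.^ r} a₁₀)))

      k₃₁ : (ξ⁻¹ p i ⊗ ⌈ A , B , D ⌉ ⊗ ξ p i) i3 i1 ≡ₚ 0ₚ [mod^ N ]
      k₃₁ = unwrap (≅-trans (≅-reflexive (conj-31 ⌈ A , B , D ⌉ N))
              (merge (≅1⇒scaled≅0 {p ℕ.^ i} {p ℕ.^ r} a₁₁ (sub-multiple (seq (D i1₂ i1₂) N) 1ℤ u P d₁₁-1≡uP))))

      k₃₂ : (ξ⁻¹ p i ⊗ ⌈ A , B , D ⌉ ⊗ ξ p i) i3 i2 ≡ₚ 0ₚ [mod^ N ]
      k₃₂ = unwrap (≅-reflexive {a = level N (ξ⁻¹ p i ⊗ ⌈ A , B , D ⌉ ⊗ ξ p i) i3 i2}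
              (trans (conj-32 ⌈ A , B , D ⌉ N) (sub-multiple (seq (D i1₂ i0₂) N) 0ℤ c P d₁₀≡cP)))

      k₃₃ : (ξ⁻¹ p i ⊗ ⌈ A , B , D ⌉ ⊗ ξ p i) i3 i3 ≡ₚ 1ₚ [mod^ N ]
      k₃₃ = unwrap (≅-reflexive {a = level N (ξ⁻¹ p i ⊗ ⌈ A , B , D ⌉ ⊗ ξ p i) i3 i3}
              (trans (conj-33 ⌈ A , B , D ⌉ N) (sub-multiple (seq (D i1₂ i1₂) N) 1ℤ u P d₁₁-1≡uP)))

image⇔K×K : ∀ {p} .{{_ : NonZero p}} n n' i → i ℕ.≤ n ℕ.+ n' → (A D : Mat p 2) →
  (InImage p i (n ℕ.+ n') A D → InKK p (n ℕ.+ n' ℕ.∸ i) i A D) ×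
  (InKK p (n ℕ.+ n' ℕ.∸ i) i A D → InImage p i (n ℕ.+ n') A D)
image⇔K×K {p} n n' i i≤n+n' A D =
  (λ im → image⇒K×K {A} {D} (subst (λ N → InImage p i N A D) (sym i+r≡n+n') im)) ,
  (λ kk → subst (λ N → InImage p i N A D) i+r≡n+n' (K×K⇒image {A} {D} kk))
  where
  open Directions {p} i (n ℕ.+ n' ℕ.∸ i)
  i+r≡n+n' : i ℕ.+ (n ℕ.+ n' ℕ.∸ i) ≡ n ℕ.+ n'
  i+r≡n+n' = ℕ.m+[n∸m]≡n i≤n+n'

mainTheorem9 : (p : ℕ) → Prime p → (n n' : ℕ) →
    ((i : ℕ) → i ℕ.≤ n ℕ.+ n' → (A D : Mat p 2) →
        (InImage p i (n ℕ.+ n') A D → InKK p (n ℕ.+ n' ℕ.∸ i) i A D)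
      × (InKK p (n ℕ.+ n' ℕ.∸ i) i A D → InImage p i (n ℕ.+ n') A D))
    × ((A D : Mat p 2) →
        (InImage p n (n ℕ.+ n') A D → InKK p n' n A D)
      × (InKK p n' n A D → InImage p n (n ℕ.+ n') A D))
    × ((A D : Mat p 2) →
        (InImage p n' (n ℕ.+ n') A D → InKK p n n' A D)
      × (InKK p n n' A D → InImage p n' (n ℕ.+ n') A D))
mainTheorem9 p p-prime n n' =
  image⇔K×K n n' ,
  specialise n (ℕ.m≤m+n n n') (ℕ.m+n∸m≡n n n') ,
  specialise n' (ℕ.m≤n+m n' n) (ℕ.m+n∸n≡m n n')
  where
  instance
    p≢0 : NonZero p
    p≢0 = prime⇒nonZero p-prime

  specialise : ∀ i → i ℕ.≤ n ℕ.+ n' → ∀ {j} → n ℕ.+ n' ℕ.∸ i ≡ j → (A D : Mat p 2) →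
               (InImage p i (n ℕ.+ n') A D → InKK p j i A D) × (InKK p j i A D → InImage p i (n ℕ.+ n') A D)
  specialise i i≤n+n' refl = image⇔K×K n n' i i≤n+n'
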